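{- For every $k>4$ and $i\in\{1,2\}$, $$\binom{\lfloor n/2\rfloor}{k-1}\le s_i(n,\# S_k,\mathcal{C})\le \binom{\lceil n/2\rceil}{k-1}.$$
   Context: Let $\mathcal{C}=\{C_3,C_4,\dots\}$ be the family of all cycles. In the $\mathcal{C}$-saturation game on $n$ vertices, Max and Mini alternately claim previously unclaimed edges of $K_n$ so that the graph of claimed edges contains no cycle; the game ends when no edge can be added, i.e. the final graph is a spanning tree. The $H$-score is the number of (not necessarily induced) subgraphs of the final graph isomorphic to $H$. Max maximizes and Mini minimizes the score; $s_1(n,\# H,\mathcal{C})$ is the optimal score when Max starts, $s_2(n,\# H,\mathcal{C})$ when Mini starts. $S_k$ denotes the star on $k$ vertices. -}

module Defs where

open import Data.Nat using (ℕ; zero; suc; _+_; _∸_; _≤_; _/_)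
open import Data.Nat.Combinatorics using (_C_)
open import Data.Fin using (Fin)
open import Data.Fin.Subset using (Subset; ∣_∣; _∈_; _∉_)
open import Data.Fin.Subset.Properties using (_∈?_)
open import Data.Fin.Properties using (all?) renaming (_≟_ to _≟ᶠ_)
open import Data.Vec using (Vec; []; _∷_)
open import Data.Bool using (true; false)
open import Data.List using (List; []; _∷_; _++_; map; length; allFin; filter)
open import Data.Nat.ListAction using (sum)
open import Data.List.Relation.Unary.Any using (Any)
import Data.List.Relation.Unary.Any as Any
open import Data.List.Relation.Unary.AllPairs using (AllPairs)
open import Data.List.Relation.Binary.Pointwise using ()
open import Data.List.Relation.Unary.Linked using (Linked)
open import Data.Product using (Σ; _×_; _,_; ∃)
open import Data.Sum using (_⊎_)
open import Data.Empty using (⊥; ⊥-elim)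
open import Relation.Nullary using (¬_; Dec; yes; no)
open import Relation.Nullary.Decidable using (_×-dec_; _⊎-dec_; ¬?)
open import Relation.Binary.PropositionalEquality using (_≡_; _≢_)
import Data.Nat.Properties as ℕP

-- Graphs on the vertex set Fin n (vertices of K_n).
-- A graph is the list of claimed edges; an edge is a pair (x , y),
-- read as the unordered pair {x , y}.

Edge : ℕ → Set
Edge n = Fin n × Fin n

Graph : ℕ → Set
Graph n = List (Edge n)

Adj : ∀ {n} → Graph n → Fin n → Fin n → Set
Adj G x y = Any (λ e → (Data.Product.proj₁ e ≡ x × Data.Product.proj₂ e ≡ y)
                     ⊎ (Data.Product.proj₁ e ≡ y × Data.Product.proj₂ e ≡ x)) G

adj? : ∀ {n} (G : Graph n) (x y : Fin n) → Dec (Adj G x y)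
adj? G x y = Any.any? (λ e → ((Data.Product.proj₁ e ≟ᶠ x) ×-dec (Data.Product.proj₂ e ≟ᶠ y))
                        ⊎-dec ((Data.Product.proj₁ e ≟ᶠ y) ×-dec (Data.Product.proj₂ e ≟ᶠ x))) G

Cycle : ∀ {n} → Graph n → Set
Cycle {n} G = Σ (Fin n) λ v → Σ (List (Fin n)) λ ws →
  (2 ≤ length ws) × AllPairs _≢_ (v ∷ ws) × Linked (Adj G) (v ∷ ws ++ v ∷ [])

Acyclic : ∀ {n} → Graph n → Set
Acyclic G = ¬ Cycle G

-- A legal move in the C-saturation game: claim a previously unclaimed
-- edge {x , y} of K_n such that the claimed graph stays acyclic.
Move : ∀ {n} → Graph n → Edge n → Set
Move G (x , y) = (x ≢ y) × ¬ Adj G x y × Acyclic ((x , y) ∷ G)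

Terminal : ∀ {n} → Graph n → Set
Terminal G = ∀ e → ¬ Move G e

-- S_k-score: number of subgraphs isomorphic to the star S_k
-- (a star S_k, k ≥ 3, is determined by its centre v and its set L of
-- k - 1 leaves, all adjacent to v).

allSubsets : (n : ℕ) → List (Subset n)
allSubsets zero    = [] ∷ []
allSubsets (suc n) = map (true ∷_) (allSubsets n) ++ map (false ∷_) (allSubsets n)

IsStar : ∀ {n} → ℕ → Graph n → Fin n → Subset n → Set
IsStar k G v L = (∣ L ∣ ≡ k ∸ 1) × (v ∉ L) × (∀ w → w ∈ L → Adj G v w)

implies? : ∀ {n} (G : Graph n) v L w → Dec (w ∈ L → Adj G v w)
implies? G v L w with w ∈? L | adj? G v w
... | _      | yes a = yes (λ _ → a)
... | no w∉  | no _  = yes (λ w∈ → ⊥-elim (w∉ w∈))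
... | yes w∈ | no ¬a = no (λ f → ¬a (f w∈))

isStar? : ∀ {n} k (G : Graph n) v L → Dec (IsStar k G v L)
isStar? k G v L =
  (∣ L ∣ ℕP.≟ (k ∸ 1)) ×-dec (¬? (v ∈? L)) ×-dec all? (implies? G v L)

starScore : ∀ {n} → ℕ → Graph n → ℕ
starScore {n} k G =
  sum (map (λ v → length (filter (isStar? k G v) (allSubsets n))) (allFin n))

data Player : Set where
  Max Mini : Player

other : Player → Player
other Max  = Mini
other Mini = Max

-- Forces me Good G p : in position G with player p to move, player `me`
-- has a strategy guaranteeing that the final graph's score satisfies Good.
data Forces {n : ℕ} (score : Graph n → ℕ) (me : Player) (Good : ℕ → Set)
     : Graph n → Player → Set where
  stop   : ∀ {G p} → Terminal G → Good (score G) → Forces score me Good G p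
  mine   : ∀ {G e} → Move G e → Forces score me Good (e ∷ G) (other me)
         → Forces score me Good G me
  theirs : ∀ {G} → ¬ Terminal G
         → (∀ e → Move G e → Forces score me Good (e ∷ G) me)
         → Forces score me Good G (other me)

-- For the S_k-score on n vertices with player `first` starting:
--   a ≤ s(n,#S_k,C)  iff  Max can force a final score ≥ a,
--   s(n,#S_k,C) ≤ b  iff  Mini can force a final score ≤ b.
LowerBound : (n k : ℕ) → Player → ℕ → Set
LowerBound n k first a = Forces {n} (starScore k) Max (a ≤_) [] first

UpperBound : (n k : ℕ) → Player → ℕ → Set
UpperBound n k first b = Forces {n} (starScore k) Mini (_≤ b) [] first

⌈_/2⌉ : ℕ → ℕ
⌈ n /2⌉ = (n + 1) / 2

{-# OPTIONS --safe #-}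
-- A final position is a spanning tree, whose S_k-score is ∑_v C(deg v, k-1).
--
-- Lower bound: Max fixes a vertex c and always joins the component of c to another one, so c gains
-- an edge in each of his moves, ⌈(n-1)/2⌉ of them if he starts; if Mini starts, c is taken to be an
-- endpoint of her first edge. Either way deg c ≥ ⌊n/2⌋ at the end.
--
-- Upper bound: for m = k-1 ≥ 3 convexity gives ∑_v C(d_v, m) ≤ C(2 + X, m), where X = ∑_v (d_v ∸ 2)
-- is the excess degree, so it suffices that Mini keeps 2X + 3 ≤ n. Mini always joins two components
-- at leaves, which leaves X unchanged, while an edge of Max raises X by at most the number of its
-- endpoints in big components (three or more vertices). A load of 1 per singleton or pair and 3 per
-- big component pays for these increases: Mini maintains 2X + load ≤ n up to the corrections `bonus`
-- and `debt`, and at the end a single big component remains.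

module Submission where

open import Defs

open import Level using (0ℓ)
open import Function using (_∘_; id; case_of_)
open import Data.Empty using (⊥; ⊥-elim)
open import Data.Bool using (true; false)
open import Data.Product as Product using (Σ; ∃; _×_; _,_; proj₁; proj₂)
open import Data.Sum as Sum using (_⊎_; inj₁; inj₂)
open import Relation.Nullary using (¬_; Dec; yes; no)
open import Relation.Nullary.Decidable using (_×-dec_; _→-dec_)
open import Relation.Unary using (Pred; Decidable; _⊆_; _≐_; _∪_)
open import Relation.Unary.Properties using (_∪?_)
open import Relation.Binary using (Rel; Symmetric; _Respects_)
open import Relation.Binary.PropositionalEquality hiding ([_])

open import Data.Nat
  using (ℕ; zero; suc; pred; _+_; _*_; _∸_; _⊓_; _/_; _≤_; _<_; _≤′_; z≤n; s≤s; ≤′-refl; ≤′-step; ⌊_/2⌋)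
open import Data.Nat.Properties
open import Algebra.Properties.CommutativeSemigroup +-commutativeSemigroup using (x∙yz≈y∙xz; x∙yz≈xz∙y)
open import Data.Nat.DivMod using (m/n≡1+[m∸n]/n)
open import Data.Nat.Combinatorics using (_C_; nCk+nC[k+1]≡[n+1]C[k+1])
open import Data.Nat.Combinatorics.Specification using (k>n⇒nCk≡0)
open import Data.Nat.ListAction using (sum)
open import Data.Nat.ListAction.Properties using (sum-↭)
open import Data.Nat.Tactic.RingSolver using (solve-∀)

open import Data.Fin using (Fin) renaming (zero to 0F; suc to sucF)
open import Data.Fin.Properties using (all?) renaming (_≟_ to _≟ᶠ_; suc-injective to sucF-injective)
open import Data.Fin.Subset using (Subset; ∣_∣; _∈_)
open import Data.Fin.Subset.Properties using (_∈?_)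
open import Data.Vec using (_∷_; here; there)
open import Data.Vec.Functional using (updateAt)
open import Data.Vec.Functional.Properties using (updateAt-updates; updateAt-minimal)

open import Data.List using (List; []; _∷_; [_]; _++_; map; length; filter; tabulate; allFin)
open import Data.List.Properties
  using (++-assoc; length-++; length-map; length-tabulate; filter-++; filter-≐; filter-none;
         map-tabulate; tabulate-cong)
open import Data.List.Membership.Propositional using () renaming (_∈_ to _∈ₗ_; _∉_ to _∉ₗ_)
open import Data.List.Membership.Propositional.Properties using (∈-∃++; ∈-++⁺ˡ; ∈-++⁺ʳ; ∈-++⁻; ∈-allFin)
open import Data.List.Relation.Unary.Any as Any using (Any; here; there)
import Data.List.Relation.Unary.Any.Properties as Any
open import Data.List.Relation.Unary.All as All using (All; []; _∷_)
import Data.List.Relation.Unary.All.Properties as All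
open import Data.List.Relation.Unary.AllPairs as AllPairs using (AllPairs; []; _∷_)
import Data.List.Relation.Unary.AllPairs.Properties as AllPairs
open import Data.List.Relation.Unary.Linked using (Linked; []; [-]; _∷_)
open import Data.List.Relation.Unary.Unique.Propositional using (Unique)
import Data.List.Relation.Unary.Unique.Propositional.Properties as Unique
open import Data.List.Relation.Binary.Disjoint.Propositional using (Disjoint)
open import Data.List.Relation.Binary.Disjoint.Propositional.Properties using () renaming (sym to Disjoint-sym)
open import Data.List.Relation.Binary.Permutation.Propositional as ↭ using (_↭_)
open import Data.List.Relation.Binary.Permutation.Propositional.Properties
  using (All-resp-↭; Any-resp-↭; ↭-length) renaming (++-comm to ↭-++-comm; map⁺ to ↭-map⁺)

-- Counting

count : ∀ {n} {P : Pred (Fin n) 0ℓ} → Decidable P → ℕ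
count {zero}  P? = 0
count {suc n} P? with P? 0F
... | yes _ = suc (count (P? ∘ sucF))
... | no  _ = count (P? ∘ sucF)

count-mono : ∀ {n} {P Q : Pred (Fin n) 0ℓ} (P? : Decidable P) (Q? : Decidable Q) →
             P ⊆ Q → count P? ≤ count Q?
count-mono {zero}  P? Q? P⊆Q = z≤n
count-mono {suc n} P? Q? P⊆Q with P? 0F | Q? 0F
... | yes p | yes _ = s≤s (count-mono (P? ∘ sucF) (Q? ∘ sucF) P⊆Q)
... | yes p | no ¬q = ⊥-elim (¬q (P⊆Q p))
... | no  _ | yes _ = m≤n⇒m≤1+n (count-mono (P? ∘ sucF) (Q? ∘ sucF) P⊆Q)
... | no  _ | no  _ = count-mono (P? ∘ sucF) (Q? ∘ sucF) P⊆Q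

count-cong : ∀ {n} {P Q : Pred (Fin n) 0ℓ} (P? : Decidable P) (Q? : Decidable Q) →
             P ≐ Q → count P? ≡ count Q?
count-cong P? Q? (P⊆Q , Q⊆P) = ≤-antisym (count-mono P? Q? P⊆Q) (count-mono Q? P? Q⊆P)

count-none : ∀ {n} {P : Pred (Fin n) 0ℓ} (P? : Decidable P) → (∀ i → ¬ P i) → count P? ≡ 0
count-none {zero}  P? ¬P = refl
count-none {suc n} P? ¬P with P? 0F
... | yes p = ⊥-elim (¬P 0F p)
... | no  _ = count-none (P? ∘ sucF) (¬P ∘ sucF)

count-∪≟-sucF : ∀ {n} {P : Pred (Fin (suc n)) 0ℓ} (P? : Decidable P) w →
               count ((P? ∪? (_≟ᶠ sucF w)) ∘ sucF) ≡ count ((P? ∘ sucF) ∪? (_≟ᶠ w))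
count-∪≟-sucF P? w = count-cong ((P? ∪? (_≟ᶠ sucF w)) ∘ sucF) ((P? ∘ sucF) ∪? (_≟ᶠ w))
                               (Sum.map₂ sucF-injective , Sum.map₂ (cong sucF))

count-insert : ∀ {n} {P : Pred (Fin n) 0ℓ} (P? : Decidable P) {w} → ¬ P w →
               count (P? ∪? (_≟ᶠ w)) ≡ suc (count P?)
count-insert {suc n} P? {0F} ¬Pw with P? 0F
... | yes Pw = ⊥-elim (¬Pw Pw)
... | no  _  = cong suc (count-cong _ (P? ∘ sucF) ((λ { (inj₁ p) → p }) , inj₁))
count-insert {suc n} P? {sucF w} ¬Pw with P? 0F | count-insert (P? ∘ sucF) ¬Pw
... | yes _ | ih = cong suc (trans (count-∪≟-sucF P? w) ih)
... | no  _ | ih = trans (count-∪≟-sucF P? w) ih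

length-filter-++ : ∀ {A : Set} {P : Pred A 0ℓ} (P? : Decidable P) xs ys →
                   length (filter P? (xs ++ ys)) ≡ length (filter P? xs) + length (filter P? ys)
length-filter-++ P? xs ys = trans (cong length (filter-++ P? xs ys)) (length-++ (filter P? xs))

length-filter-map : ∀ {A B : Set} {P : Pred B 0ℓ} (P? : Decidable P) (f : A → B) xs →
                    length (filter P? (map f xs)) ≡ length (filter (P? ∘ f) xs)
length-filter-map P? f [] = refl
length-filter-map P? f (x ∷ xs) with P? (f x)
... | yes _ = cong suc (length-filter-map P? f xs)
... | no  _ = length-filter-map P? f xs

length-filter-none : ∀ {A : Set} {P : Pred A 0ℓ} (P? : Decidable P) → (∀ x → ¬ P x) →
                     ∀ xs → length (filter P? xs) ≡ 0
length-filter-none P? ¬P xs = cong length (filter-none P? (All.universal ¬P xs))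

Chooses : ∀ {n} → Pred (Fin n) 0ℓ → ℕ → Pred (Subset n) 0ℓ
Chooses P j L = (∣ L ∣ ≡ j) × (∀ w → w ∈ L → P w)

chooses? : ∀ {n} {P : Pred (Fin n) 0ℓ} → Decidable P → ∀ j → Decidable (Chooses P j)
chooses? P? j L = (∣ L ∣ ≟ j) ×-dec all? (λ w → (w ∈? L) →-dec P? w)

count-subsets : ∀ {n} {P : Pred (Fin n) 0ℓ} (P? : Decidable P) j →
                length (filter (chooses? P? j) (allSubsets n)) ≡ count P? C j
count-subsets {zero}  P? zero    = refl
count-subsets {zero}  P? (suc j) = refl
count-subsets {suc n} {P} P? j = begin
  length (filter (chooses? P? j) (map (true ∷_) Ls ++ map (false ∷_) Ls))
    ≡⟨ length-filter-++ (chooses? P? j) (map (true ∷_) Ls) _ ⟩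
  length (filter (chooses? P? j) (map (true ∷_) Ls)) + length (filter (chooses? P? j) (map (false ∷_) Ls))
    ≡⟨ cong₂ _+_ (length-filter-map (chooses? P? j) (true ∷_) Ls)
                 (trans (length-filter-map (chooses? P? j) (false ∷_) Ls) avoiding-0) ⟩
  length (filter (chooses? P? j ∘ (true ∷_)) Ls) + count P′? C j
    ≡⟨ add-containing-0 j ⟩
  count P? C j ∎
  where
  open ≡-Reasoning
  Ls = allSubsets n
  P′? : Decidable (P ∘ sucF)
  P′? = P? ∘ sucF
  drop-0 : ∀ {j} → Chooses P j ∘ (false ∷_) ≐ Chooses (P ∘ sucF) j
  drop-0 = (λ (size , ⊆P) → size , λ w w∈ → ⊆P (sucF w) (there w∈))
         , (λ (size , ⊆P) → size , λ { (sucF w) (there w∈) → ⊆P w w∈ })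
  avoiding-0 : length (filter (chooses? P? j ∘ (false ∷_)) Ls) ≡ count P′? C j
  avoiding-0 = trans (cong length (filter-≐ _ (chooses? P′? j) drop-0 Ls)) (count-subsets P′? j)
  add-containing-0 : ∀ j → length (filter (chooses? P? j ∘ (true ∷_)) Ls) + count P′? C j ≡ count P? C j
  add-containing-0 j with P? 0F
  add-containing-0 zero    | _     = cong (_+ 1) (length-filter-none _ (λ _ ()) Ls)
  add-containing-0 (suc j) | yes p =
    trans (cong (_+ count P′? C suc j) (trans (cong length (filter-≐ _ (chooses? P′? j) take-0 Ls))
                                              (count-subsets P′? j)))
          (nCk+nC[k+1]≡[n+1]C[k+1] (count P′?) j)
    where
    take-0 : Chooses P (suc j) ∘ (true ∷_) ≐ Chooses (P ∘ sucF) j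
    take-0 = (λ (size , ⊆P) → suc-injective size , λ w w∈ → ⊆P (sucF w) (there w∈))
           , (λ (size , ⊆P) → cong suc size , λ { 0F here → p ; (sucF w) (there w∈) → ⊆P w w∈ })
  add-containing-0 (suc j) | no ¬p =
    cong (_+ count P′? C suc j) (length-filter-none _ (λ L (_ , ⊆P) → ¬p (⊆P 0F here)) Ls)

-- Binomial coefficients, halves and sums

nCk≤[1+n]Ck : ∀ n k → n C k ≤ suc n C k
nCk≤[1+n]Ck n zero    = ≤-refl
nCk≤[1+n]Ck n (suc k) = subst (n C suc k ≤_) (nCk+nC[k+1]≡[n+1]C[k+1] n k) (m≤n+m _ _)

C-monoˡ : ∀ k {m n} → m ≤ n → m C k ≤ n C k
C-monoˡ k = go ∘ ≤⇒≤′
  where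
  go : ∀ {m n} → m ≤′ n → m C k ≤ n C k
  go ≤′-refl       = ≤-refl
  go (≤′-step m≤n) = ≤-trans (go m≤n) (nCk≤[1+n]Ck _ k)

[2+a]Ck+[2+b]Ck≤[2+a+b]Ck : ∀ {k} → 3 ≤ k → ∀ a b → (2 + a) C k + (2 + b) C k ≤ (2 + (a + b)) C k
[2+a]Ck+[2+b]Ck≤[2+a+b]Ck {k} 3≤k a zero = begin
  (2 + a) C k + 2 C k   ≡⟨ cong ((2 + a) C k +_) (k>n⇒nCk≡0 3≤k) ⟩
  (2 + a) C k + 0       ≡⟨ cong (λ x → (2 + x) C k + 0) (sym (+-identityʳ a)) ⟩
  (2 + (a + 0)) C k + 0 ≡⟨ +-identityʳ _ ⟩
  (2 + (a + 0)) C k     ∎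
  where open ≤-Reasoning
[2+a]Ck+[2+b]Ck≤[2+a+b]Ck {suc k} 3≤k a (suc b) = begin
  (2 + a) C suc k + (2 + suc b) C suc k
    ≡⟨ cong ((2 + a) C suc k +_) (sym (nCk+nC[k+1]≡[n+1]C[k+1] (2 + b) k)) ⟩
  (2 + a) C suc k + ((2 + b) C k + (2 + b) C suc k)
    ≡⟨ x∙yz≈xz∙y ((2 + a) C suc k) ((2 + b) C k) _ ⟩
  ((2 + a) C suc k + (2 + b) C suc k) + (2 + b) C k
    ≤⟨ +-mono-≤ ([2+a]Ck+[2+b]Ck≤[2+a+b]Ck 3≤k a b) (C-monoˡ k (+-monoʳ-≤ 2 (m≤n+m b a))) ⟩
  (2 + (a + b)) C suc k + (2 + (a + b)) C k
    ≡⟨ +-comm _ ((2 + (a + b)) C k) ⟩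
  (2 + (a + b)) C k + (2 + (a + b)) C suc k
    ≡⟨ nCk+nC[k+1]≡[n+1]C[k+1] (2 + (a + b)) k ⟩
  (3 + (a + b)) C suc k
    ≡⟨ cong (λ x → (2 + x) C suc k) (sym (+-suc a b)) ⟩
  (2 + (a + suc b)) C suc k ∎
  where open ≤-Reasoning

nCk≤[2+[n∸2]]Ck : ∀ {k} → 3 ≤ k → ∀ n → n C k ≤ (2 + (n ∸ 2)) C k
nCk≤[2+[n∸2]]Ck {k} 3≤k 0         = subst (_≤ 2 C k) (sym (k>n⇒nCk≡0 (≤-trans (s≤s z≤n) 3≤k))) z≤n
nCk≤[2+[n∸2]]Ck {k} 3≤k 1         = subst (_≤ 2 C k) (sym (k>n⇒nCk≡0 (≤-trans (s≤s (s≤s z≤n)) 3≤k))) z≤n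
nCk≤[2+[n∸2]]Ck 3≤k (suc (suc n)) = ≤-refl

⌊n/2⌋≡n/2 : ∀ n → ⌊ n /2⌋ ≡ n / 2
⌊n/2⌋≡n/2 0             = refl
⌊n/2⌋≡n/2 1             = refl
⌊n/2⌋≡n/2 (suc (suc n)) = trans (cong suc (⌊n/2⌋≡n/2 n)) (sym (m/n≡1+[m∸n]/n {2 + n} (s≤s (s≤s z≤n))))

2*m≤n⇒m≤⌊n/2⌋ : ∀ {m n} → 2 * m ≤ n → m ≤ ⌊ n /2⌋
2*m≤n⇒m≤⌊n/2⌋ {m} {n} 2m≤n =
  subst (_≤ ⌊ n /2⌋) (sym (n≡⌊n+n/2⌋ m)) (⌊n/2⌋-mono (subst (_≤ n) (cong (m +_) (+-identityʳ m)) 2m≤n))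

2*m+1≤2⇒m≡0 : ∀ {m} → 2 * m + 1 ≤ 2 → m ≡ 0
2*m+1≤2⇒m≡0 {zero}  _ = refl
2*m+1≤2⇒m≡0 {suc m} h with ≤-trans (+-monoˡ-≤ 1 (*-monoʳ-≤ 2 (s≤s (z≤n {m})))) h
... | s≤s (s≤s ())

∑ : ∀ {n} → (Fin n → ℕ) → ℕ
∑ f = sum (tabulate f)

∑-mono : ∀ {n} {f g : Fin n → ℕ} → (∀ i → f i ≤ g i) → ∑ f ≤ ∑ g
∑-mono {zero}  f≤g = z≤n
∑-mono {suc n} f≤g = +-mono-≤ (f≤g 0F) (∑-mono (f≤g ∘ sucF))

f≤∑f : ∀ {n} (f : Fin n → ℕ) i → f i ≤ ∑ f
f≤∑f f 0F       = m≤m+n _ _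
f≤∑f f (sucF i) = ≤-trans (f≤∑f (f ∘ sucF) i) (m≤n+m _ _)

∑-updateAt : ∀ {n} (f : Fin n → ℕ) i a → ∑ (updateAt f i (a +_)) ≡ a + ∑ f
∑-updateAt f 0F       a = +-assoc a (f 0F) _
∑-updateAt f (sucF i) a = begin
  f 0F + ∑ (updateAt (f ∘ sucF) i (a +_)) ≡⟨ cong (f 0F +_) (∑-updateAt (f ∘ sucF) i a) ⟩
  f 0F + (a + ∑ (f ∘ sucF))               ≡⟨ x∙yz≈y∙xz (f 0F) a _ ⟩
  a + (f 0F + ∑ (f ∘ sucF))               ∎
  where open ≡-Reasoning

∑-zero : ∀ n → ∑ {n} (λ _ → 0) ≡ 0
∑-zero zero    = refl
∑-zero (suc n) = ∑-zero n

∑-C≤ : ∀ {k} → 3 ≤ k → ∀ {n} (d : Fin n → ℕ) → ∑ (λ v → d v C k) ≤ (2 + ∑ (λ v → d v ∸ 2)) C k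
∑-C≤ 3≤k {zero}  d = z≤n
∑-C≤ {k} 3≤k {suc n} d = begin
  d 0F C k + ∑ (λ v → d (sucF v) C k)
    ≤⟨ +-mono-≤ (nCk≤[2+[n∸2]]Ck 3≤k (d 0F)) (∑-C≤ 3≤k (d ∘ sucF)) ⟩
  (2 + (d 0F ∸ 2)) C k + (2 + ∑ (λ v → d (sucF v) ∸ 2)) C k
    ≤⟨ [2+a]Ck+[2+b]Ck≤[2+a+b]Ck 3≤k (d 0F ∸ 2) _ ⟩
  (2 + ∑ (λ v → d v ∸ 2)) C k ∎
  where open ≤-Reasoning

-- Degrees and the star score

adj-sym : ∀ {n} {G : Graph n} {a b} → Adj G a b → Adj G b a
adj-sym = Any.map Sum.swap

Loopless : ∀ {n} → Graph n → Set
Loopless G = ∀ v → ¬ Adj G v v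

deg : ∀ {n} → Graph n → Fin n → ℕ
deg G v = count (adj? G v)

deg-[] : ∀ {n} (v : Fin n) → deg [] v ≡ 0
deg-[] v = count-none (adj? [] v) (λ _ ())

deg-∷-≤ : ∀ {n} {G : Graph n} e v → deg G v ≤ deg (e ∷ G) v
deg-∷-≤ {G = G} e v = count-mono (adj? G v) (adj? (e ∷ G) v) Any.there

module _ {n} {G : Graph n} {x y : Fin n} (x≢y : x ≢ y) (¬xy : ¬ Adj G x y) where

  deg-∷-left : deg ((x , y) ∷ G) x ≡ suc (deg G x)
  deg-∷-left = trans (count-cong (adj? ((x , y) ∷ G) x) (adj? G x ∪? (_≟ᶠ y)) (from , to))
                     (count-insert (adj? G x) ¬xy)
    where
    from : Adj ((x , y) ∷ G) x ⊆ Adj G x ∪ (_≡ y)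
    from (here (inj₁ (_ , y≡w)))  = inj₂ (sym y≡w)
    from (here (inj₂ (_ , y≡x)))  = ⊥-elim (x≢y (sym y≡x))
    from (there xw)               = inj₁ xw
    to : Adj G x ∪ (_≡ y) ⊆ Adj ((x , y) ∷ G) x
    to (inj₁ xw)   = there xw
    to (inj₂ refl) = here (inj₁ (refl , refl))

  deg-∷-right : deg ((x , y) ∷ G) y ≡ suc (deg G y)
  deg-∷-right = trans (count-cong (adj? ((x , y) ∷ G) y) (adj? G y ∪? (_≟ᶠ x)) (from , to))
                      (count-insert (adj? G y) (¬xy ∘ adj-sym))
    where
    from : Adj ((x , y) ∷ G) y ⊆ Adj G y ∪ (_≡ x)
    from (here (inj₁ (x≡y , _)))  = ⊥-elim (x≢y x≡y)
    from (here (inj₂ (x≡w , _)))  = inj₂ (sym x≡w)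
    from (there yw)               = inj₁ yw
    to : Adj G y ∪ (_≡ x) ⊆ Adj ((x , y) ∷ G) y
    to (inj₁ yw)   = there yw
    to (inj₂ refl) = here (inj₂ (refl , refl))

  deg-∷-other : ∀ {v} → v ≢ x → v ≢ y → deg ((x , y) ∷ G) v ≡ deg G v
  deg-∷-other {v} v≢x v≢y = count-cong (adj? ((x , y) ∷ G) v) (adj? G v) (from , Any.there)
    where
    from : Adj ((x , y) ∷ G) v ⊆ Adj G v
    from (here (inj₁ (x≡v , _))) = ⊥-elim (v≢x (sym x≡v))
    from (here (inj₂ (_ , y≡v))) = ⊥-elim (v≢y (sym y≡v))
    from (there vw)              = vw

starScore≡∑deg : ∀ {n} k (G : Graph n) → Loopless G →
                 starScore k G ≡ ∑ (λ v → deg G v C (k ∸ 1))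
starScore≡∑deg {n} k G loopless = begin
  sum (map stars (tabulate id)) ≡⟨ cong sum (map-tabulate id stars) ⟩
  sum (tabulate stars)          ≡⟨ cong sum (tabulate-cong stars≡) ⟩
  ∑ (λ v → deg G v C (k ∸ 1))   ∎
  where
  open ≡-Reasoning
  stars : Fin n → ℕ
  stars v = length (filter (isStar? k G v) (allSubsets n))
  stars≡ : ∀ v → stars v ≡ deg G v C (k ∸ 1)
  stars≡ v = trans (cong length (filter-≐ (isStar? k G v) (chooses? (adj? G v) (k ∸ 1))
                     ((λ (size , _ , ⊆N) → size , ⊆N) , (λ (size , ⊆N) → size , (λ v∈ → loopless v (⊆N v v∈)) , ⊆N))
                     (allSubsets n)))
                   (count-subsets (adj? G v) (k ∸ 1))

AllPairs-resp-↭ : ∀ {A : Set} {R : A → A → Set} → Symmetric R → (AllPairs R) Respects _↭_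
AllPairs-resp-↭ sym-R ↭.refl            rs                     = rs
AllPairs-resp-↭ sym-R (↭.prep x p)      (r ∷ rs)               = All-resp-↭ p r ∷ AllPairs-resp-↭ sym-R p rs
AllPairs-resp-↭ sym-R (↭.swap x y p)    ((rxy ∷ rx) ∷ (ry ∷ rs)) =
  (sym-R rxy ∷ All-resp-↭ p ry) ∷ All-resp-↭ p rx ∷ AllPairs-resp-↭ sym-R p rs
AllPairs-resp-↭ sym-R (↭.trans p q)     rs                     =
  AllPairs-resp-↭ sym-R q (AllPairs-resp-↭ sym-R p rs)

module _ {A : Set} where

  lastOf : A → List A → A
  lastOf a []       = a
  lastOf a (b ∷ bs) = lastOf b bs

  lastOf-∈ : ∀ a bs → lastOf a bs ∈ₗ a ∷ bs
  lastOf-∈ a []       = here refl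
  lastOf-∈ a (b ∷ bs) = there (lastOf-∈ b bs)

module _ {A : Set} {R : Rel A 0ℓ} where

  Linked-∷ʳ⁻ : ∀ a bs {z} → Linked R (a ∷ bs ++ [ z ]) → Linked R (a ∷ bs) × R (lastOf a bs) z
  Linked-∷ʳ⁻ a []       (r ∷ [-]) = [-] , r
  Linked-∷ʳ⁻ a (b ∷ bs) (r ∷ rs)  = Product.map₁ (r ∷_) (Linked-∷ʳ⁻ b bs rs)

  Linked-∷ʳ⁺ : ∀ a bs {z} → Linked R (a ∷ bs) → R (lastOf a bs) z → Linked R (a ∷ bs ++ [ z ])
  Linked-∷ʳ⁺ a []       [-]      r = r ∷ [-]
  Linked-∷ʳ⁺ a (b ∷ bs) (r ∷ rs) s = r ∷ Linked-∷ʳ⁺ b bs rs s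

  Linked-split : ∀ as b bs → Linked R (as ++ b ∷ bs) → Linked R (as ++ [ b ]) × Linked R (b ∷ bs)
  Linked-split []           b bs rs       = [-] , rs
  Linked-split (a ∷ [])     b bs (r ∷ rs) = r ∷ [-] , rs
  Linked-split (a ∷ a′ ∷ as) b bs (r ∷ rs) = Product.map₁ (r ∷_) (Linked-split (a′ ∷ as) b bs rs)

  Linked-join : ∀ as b bs → Linked R (as ++ [ b ]) → Linked R (b ∷ bs) → Linked R (as ++ b ∷ bs)
  Linked-join []            b bs _        rs = rs
  Linked-join (a ∷ [])      b bs (r ∷ _)  rs = r ∷ rs
  Linked-join (a ∷ a′ ∷ as) b bs (r ∷ rs) ss = r ∷ Linked-join (a′ ∷ as) b bs rs ss

  Linked-preserves : ∀ {S : Pred A 0ℓ} → (∀ {a b} → R a b → S a → S b) →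
                     ∀ a bs → Linked R (a ∷ bs) → S a → S (lastOf a bs)
  Linked-preserves step a []       _        s = s
  Linked-preserves step a (b ∷ bs) (r ∷ rs) s = Linked-preserves step b bs rs (step r s)

  Linked-restrict : ∀ {P : Pred A 0ℓ} {R′ : Rel A 0ℓ} → (∀ {a b} → P a → P b → R a b → R′ a b) →
                    ∀ {as} → All P as → Linked R as → Linked R′ as
  Linked-restrict f _              []       = []
  Linked-restrict f _              [-]      = [-]
  Linked-restrict f (pa ∷ pb ∷ ps) (r ∷ rs) = f pa pb r ∷ Linked-restrict f (pb ∷ ps) rs

-- Walks, paths and acyclicity

data Walk {n} (G : Graph n) : Fin n → Fin n → Set where
  []  : ∀ {a} → Walk G a a
  _∷_ : ∀ {a b c} → Adj G a b → Walk G b c → Walk G a c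

visits : ∀ {n} {G : Graph n} {a b} → Walk G a b → List (Fin n)
visits []                = []
visits (_∷_ {b = b} _ w) = b ∷ visits w

weaken : ∀ {n} {G : Graph n} {e a b} → Walk G a b → Walk (e ∷ G) a b
weaken []      = []
weaken (r ∷ w) = there r ∷ weaken w

visits-weaken : ∀ {n} {G : Graph n} {e a b} (w : Walk G a b) → visits (weaken {e = e} w) ≡ visits w
visits-weaken []      = refl
visits-weaken (r ∷ w) = cong (_ ∷_) (visits-weaken w)

module _ {n} {G : Graph n} where

  _++ʷ_ : ∀ {a b c} → Walk G a b → Walk G b c → Walk G a c
  []      ++ʷ w′ = w′
  (e ∷ w) ++ʷ w′ = e ∷ (w ++ʷ w′)

  visits-++ʷ : ∀ {a b c} (w : Walk G a b) (w′ : Walk G b c) → visits (w ++ʷ w′) ≡ visits w ++ visits w′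
  visits-++ʷ []      w′ = refl
  visits-++ʷ (e ∷ w) w′ = cong (_ ∷_) (visits-++ʷ w w′)

  Linked-visits : ∀ {R : Rel (Fin n) 0ℓ} → (∀ {a b} → Adj G a b → R a b) →
                  ∀ {a b c} (w : Walk G a b) → R b c → Linked R (a ∷ visits w ++ [ c ])
  Linked-visits f []      r = r ∷ [-]
  Linked-visits f (e ∷ w) r = f e ∷ Linked-visits f w r

  path-closes-cycle : ∀ {x y} (w : Walk G y x) → Unique (y ∷ visits w) → x ≢ y → ¬ Adj G x y →
                      Cycle ((x , y) ∷ G)
  path-closes-cycle []             _  x≢y _   = ⊥-elim (x≢y refl)
  path-closes-cycle (e ∷ [])       _  _   ¬xy = ⊥-elim (¬xy (adj-sym e))
  path-closes-cycle w@(_ ∷ _ ∷ _) uq _   _   =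
    _ , visits w , s≤s (s≤s z≤n) , uq , Linked-visits there w (here (inj₁ (refl , refl)))

CycleThrough : ∀ {n} → Graph n → Fin n → List (Fin n) → Set
CycleThrough G v ws = (2 ≤ length ws) × AllPairs _≢_ (v ∷ ws) × Linked (Adj G) (v ∷ ws ++ [ v ])

rotate : ∀ {n} {G : Graph n} {v u} ws₁ ws₂ → CycleThrough G v (ws₁ ++ u ∷ ws₂) → CycleThrough G u (ws₂ ++ v ∷ ws₁)
rotate {G = G} {v} {u} ws₁ ws₂ (len , uq , lk) = len′ , uq′ , lk′
  where
  perm : (v ∷ ws₁) ++ (u ∷ ws₂) ↭ (u ∷ ws₂) ++ (v ∷ ws₁)
  perm = ↭-++-comm (v ∷ ws₁) (u ∷ ws₂)
  len′ : 2 ≤ length (ws₂ ++ v ∷ ws₁)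
  len′ = subst (2 ≤_) (suc-injective (↭-length perm)) len
  uq′ : AllPairs _≢_ (u ∷ ws₂ ++ v ∷ ws₁)
  uq′ = AllPairs-resp-↭ ≢-sym perm uq
  halves : Linked (Adj G) ((v ∷ ws₁) ++ [ u ]) × Linked (Adj G) (u ∷ ws₂ ++ [ v ])
  halves = Linked-split (v ∷ ws₁) u (ws₂ ++ [ v ])
             (subst (λ zs → Linked (Adj G) (v ∷ zs)) (++-assoc ws₁ (u ∷ ws₂) [ v ]) lk)
  lk′ : Linked (Adj G) (u ∷ (ws₂ ++ v ∷ ws₁) ++ [ u ])
  lk′ = subst (λ zs → Linked (Adj G) (u ∷ zs)) (sym (++-assoc ws₂ (v ∷ ws₁) [ u ]))
          (Linked-join (u ∷ ws₂) v (ws₁ ++ [ u ]) (proj₂ halves) (proj₁ halves))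

Adj-∷-avoiding : ∀ {n} {G : Graph n} {x y a b} → a ≢ x → b ≢ x → Adj ((x , y) ∷ G) a b → Adj G a b
Adj-∷-avoiding a≢x b≢x (here (inj₁ (x≡a , _))) = ⊥-elim (a≢x (sym x≡a))
Adj-∷-avoiding a≢x b≢x (here (inj₂ (x≡b , _))) = ⊥-elim (b≢x (sym x≡b))
Adj-∷-avoiding a≢x b≢x (there ab)              = ab

-- A cycle through the new edge xy would have to return from ∁ S into S along an old edge.
module _ {n} {G : Graph n} {x y} (S : Pred (Fin n) 0ℓ) (closed : ∀ {a b} → Adj G a b → S a → S b)
         (Sx : S x) (¬Sy : ¬ S y) (acyclic : Acyclic G) where

  no-cycle-through-bridge : ∀ ws → CycleThrough ((x , y) ∷ G) x ws → ⊥
  no-cycle-through-bridge (u ∷ []) (s≤s () , _)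
  no-cycle-through-bridge (u ∷ rest@(r ∷ rs)) (len , uq@(x≢ ∷ u≢ ∷ _) , first ∷ lk) =
    ends first (proj₂ (Linked-∷ʳ⁻ u rest lk))
    where
    interior : Linked (Adj G) (u ∷ rest)
    interior = Linked-restrict Adj-∷-avoiding (All.map ≢-sym x≢) (proj₁ (Linked-∷ʳ⁻ u rest lk))
    ¬S-closed : ∀ {a b} → Adj G a b → ¬ S a → ¬ S b
    ¬S-closed ab ¬Sa Sb = ¬Sa (closed (adj-sym ab) Sb)
    z = lastOf u rest
    ends : Adj ((x , y) ∷ G) x u → Adj ((x , y) ∷ G) z x → ⊥
    ends (here (inj₂ (x≡u , _))) _ = All.head x≢ x≡u
    ends _ (here (inj₁ (x≡z , _))) = All.lookup x≢ (lastOf-∈ u rest) x≡z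
    ends (there xu) (there zx) = acyclic (x , u ∷ rest , len , uq , xu ∷ Linked-∷ʳ⁺ u rest interior zx)
    ends (here (inj₁ (_ , y≡u))) (there zx) =
      Linked-preserves ¬S-closed u rest interior (subst (¬_ ∘ S) y≡u ¬Sy) (closed (adj-sym zx) Sx)
    ends (there xu) (here (inj₂ (_ , y≡z))) =
      ¬Sy (subst S (sym y≡z) (Linked-preserves closed u rest interior (closed xu Sx)))
    ends (here (inj₁ (_ , y≡u))) (here (inj₂ (_ , y≡z))) = All.lookup u≢ (lastOf-∈ r rs) (trans (sym y≡u) y≡z)

  open import Data.List.Membership.DecPropositional (_≟ᶠ_ {n}) using () renaming (_∈?_ to _∈ₗ?_)

  acyclic-bridge : Acyclic ((x , y) ∷ G)
  acyclic-bridge (v , ws , cyc) with x ∈ₗ? (v ∷ ws)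
  ... | no x∉ = acyclic (v , ws , Product.map₂ (Product.map₂ (Linked-restrict Adj-∷-avoiding avoid-x)) cyc)
    where
    avoid-x : All (_≢ x) (v ∷ ws ++ [ v ])
    avoid-x = All.++⁺ {xs = v ∷ ws} (All.tabulate λ u∈ u≡x → x∉ (subst (_∈ₗ v ∷ ws) u≡x u∈))
                                   ((λ v≡x → x∉ (here (sym v≡x))) ∷ [])
  ... | yes (here x≡v)   = no-cycle-through-bridge ws (subst (λ u → CycleThrough _ u ws) (sym x≡v) cyc)
  ... | yes (there x∈ws) with ∈-∃++ x∈ws
  ...   | ws₁ , ws₂ , refl = no-cycle-through-bridge (ws₂ ++ v ∷ ws₁) (rotate ws₁ ws₂ cyc)

-- Partitions into components

Block : ℕ → Set
Block n = List (Fin n)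

PathIn : ∀ {n} → Graph n → Block n → Fin n → Fin n → Set
PathIn G B a b = Σ (Walk G a b) λ w → Unique (a ∷ visits w) × All (_∈ₗ B) (a ∷ visits w)

Connected : ∀ {n} → Graph n → Block n → Set
Connected G B = ∀ {a b} → a ∈ₗ B → b ∈ₗ B → PathIn G B a b

record Components {n} (G : Graph n) (bs : List (Block n)) : Set where
  field
    cover     : ∀ v → Any (v ∈ₗ_) bs
    disjoint  : AllPairs Disjoint bs
    unique    : All Unique bs
    nonempty  : All (λ B → ∃ (_∈ₗ B)) bs
    connected : All (Connected G) bs
    internal  : ∀ {a b} → Adj G a b → Any (λ B → a ∈ₗ B × b ∈ₗ B) bs
    acyclic   : Acyclic G
    loopless  : Loopless G
    size      : sum (map length bs) ≡ n

open Components public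

module _ {n} {G : Graph n} where

  PathIn-mono : ∀ {B B′ a b} → (∀ {v} → v ∈ₗ B → v ∈ₗ B′) → PathIn G B a b → PathIn G B′ a b
  PathIn-mono B⊆B′ (w , uq , inB) = w , uq , All.map B⊆B′ inB

  PathIn-weaken : ∀ {e B a b} → PathIn G B a b → PathIn (e ∷ G) B a b
  PathIn-weaken {a = a} (w , uq , inB) =
    weaken w , subst (λ vs → Unique (a ∷ vs)) (sym (visits-weaken w)) uq
             , subst (λ vs → All (_∈ₗ _) (a ∷ vs)) (sym (visits-weaken w)) inB

  PathIn-join : ∀ {B B′ a u u′ b} → Disjoint B B′ → PathIn G B a u → Adj G u u′ → PathIn G B′ u′ b →
                PathIn G (B ++ B′) a b
  PathIn-join {B} {B′} {a} {u′ = u′} B#B′ (w , uq , inB) e (w′ , uq′ , inB′) =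
    w ++ʷ (e ∷ w′) , subst (λ vs → Unique (a ∷ vs)) (sym eq) uq″
                   , subst (λ vs → All (_∈ₗ B ++ B′) (a ∷ vs)) (sym eq) inB″
    where
    eq : visits (w ++ʷ (e ∷ w′)) ≡ visits w ++ u′ ∷ visits w′
    eq = visits-++ʷ w (e ∷ w′)
    uq″ : Unique ((a ∷ visits w) ++ (u′ ∷ visits w′))
    uq″ = Unique.++⁺ uq uq′ λ (v∈ , v∈′) → B#B′ (All.lookup inB v∈ , All.lookup inB′ v∈′)
    inB″ : All (_∈ₗ B ++ B′) ((a ∷ visits w) ++ (u′ ∷ visits w′))
    inB″ = All.++⁺ (All.map ∈-++⁺ˡ inB) (All.map (∈-++⁺ʳ B) inB′)

  path-blocks-move : ∀ {B x y} → PathIn G B y x → ¬ Move G (x , y)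
  path-blocks-move (w , uq , _) (x≢y , ¬xy , acyclic′) = acyclic′ (path-closes-cycle w uq x≢y ¬xy)

extract : ∀ {A : Set} {P : Pred A 0ℓ} {xs} → Any P xs → ∃ λ x → ∃ λ rest → xs ↭ x ∷ rest × P x
extract {xs = x ∷ xs} (here px) = x , xs , ↭.refl , px
extract {xs = x ∷ xs} (there any) with extract any
... | y , rest , xs↭ , py = y , x ∷ rest , ↭.trans (↭.prep x xs↭) (↭.swap x y ↭.refl) , py

∈-++-swap : ∀ {A : Set} (xs : List A) {ys v} → v ∈ₗ xs ++ ys → v ∈ₗ ys ++ xs
∈-++-swap xs {ys} v∈ with ∈-++⁻ xs v∈
... | inj₁ v∈xs = ∈-++⁺ʳ ys v∈xs
... | inj₂ v∈ys = ∈-++⁺ˡ v∈ys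

Disjoint-++ˡ : ∀ {A : Set} {xs ys zs : List A} → Disjoint xs zs → Disjoint ys zs → Disjoint (xs ++ ys) zs
Disjoint-++ˡ {xs = xs} xs#zs ys#zs (v∈ , v∈zs) with ∈-++⁻ xs v∈
... | inj₁ v∈xs = xs#zs (v∈xs , v∈zs)
... | inj₂ v∈ys = ys#zs (v∈ys , v∈zs)

module _ {n} {G : Graph n} where

  Components-↭ : ∀ {bs bs′} → bs ↭ bs′ → Components G bs → Components G bs′
  Components-↭ bs↭ cs = record
    { cover     = λ v → Any-resp-↭ bs↭ (cover cs v)
    ; disjoint  = AllPairs-resp-↭ Disjoint-sym bs↭ (disjoint cs)
    ; unique    = All-resp-↭ bs↭ (unique cs)
    ; nonempty  = All-resp-↭ bs↭ (nonempty cs)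
    ; connected = All-resp-↭ bs↭ (connected cs)
    ; internal  = λ e → Any-resp-↭ bs↭ (internal cs e)
    ; acyclic   = acyclic cs
    ; loopless  = loopless cs
    ; size      = trans (sym (sum-↭ (↭-map⁺ length bs↭))) (size cs)
    }

  one-component-terminal : ∀ {B} → Components G (B ∷ []) → Terminal G
  one-component-terminal cs (x , y) with cover cs x | cover cs y | connected cs
  ... | here x∈ | here y∈ | conn ∷ [] = path-blocks-move (conn y∈ x∈)

  data Separated (bs : List (Block n)) (x y : Fin n) : Set where
    separated : ∀ B₁ B₂ rest → bs ↭ B₁ ∷ B₂ ∷ rest → x ∈ₗ B₁ → y ∈ₗ B₂ → Separated bs x y

  move-separates : ∀ {bs x y} → Components G bs → Move G (x , y) → Separated bs x y
  move-separates {x = x} {y} cs move with extract (cover cs x)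
  ... | B₁ , rest , bs↭ , x∈ with Any-resp-↭ bs↭ (cover cs y) | connected (Components-↭ bs↭ cs)
  ...   | here y∈    | conn ∷ _ = ⊥-elim (path-blocks-move (conn y∈ x∈) move)
  ...   | there y∈rest | _ with extract y∈rest
  ...     | B₂ , rest′ , rest↭ , y∈ = separated B₁ B₂ rest′ (↭.trans bs↭ (↭.prep B₁ rest↭)) x∈ y∈

  module _ {B₁ B₂ rest} (cs : Components G (B₁ ∷ B₂ ∷ rest)) {x y} (x∈ : x ∈ₗ B₁) (y∈ : y ∈ₗ B₂) where

    private
      B₁#B₂ : Disjoint B₁ B₂
      B₁#B₂ = All.head (AllPairs.head (disjoint cs))

      x≢y : x ≢ y
      x≢y refl = B₁#B₂ (x∈ , y∈)

      stays-in-B₁ : ∀ {a b} → Adj G a b → a ∈ₗ B₁ → b ∈ₗ B₁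
      stays-in-B₁ ab a∈ with internal cs ab | disjoint cs
      ... | here (_ , b∈)              | _                = b∈
      ... | there (here (a∈₂ , _))     | _                = ⊥-elim (B₁#B₂ (a∈ , a∈₂))
      ... | there (there a∈rest)       | (_ ∷ B₁#rest) ∷ _ with All.lookupAny B₁#rest a∈rest
      ...   | B₁#B , (a∈B , _) = ⊥-elim (B₁#B (a∈ , a∈B))

    join-move : Move G (x , y)
    join-move = x≢y , (λ xy → B₁#B₂ (stays-in-B₁ xy x∈ , y∈))
              , acyclic-bridge (_∈ₗ B₁) stays-in-B₁ x∈ (λ y∈₁ → B₁#B₂ (y∈₁ , y∈)) (acyclic cs)

    join-components : Components ((x , y) ∷ G) ((B₁ ++ B₂) ∷ rest)
    join-components = record
      { cover     = λ v → joined-cover (cover cs v)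
      ; disjoint  = All.zipWith (Product.uncurry Disjoint-++ˡ) (B₁#rest , B₂#rest) ∷ rest#
      ; unique    = Unique.++⁺ (All.head (unique cs)) (All.head (All.tail (unique cs))) B₁#B₂
                    ∷ All.tail (All.tail (unique cs))
      ; nonempty  = (x , ∈-++⁺ˡ x∈) ∷ All.tail (All.tail (nonempty cs))
      ; connected = joined-connected ∷ All.map (λ conn {a} {b} a∈ b∈ → PathIn-weaken (conn a∈ b∈))
                                               (All.tail (All.tail (connected cs)))
      ; internal  = joined-internal
      ; acyclic   = proj₂ (proj₂ join-move)
      ; loopless  = joined-loopless
      ; size      = trans (cong (_+ sum (map length rest)) (length-++ B₁))
                          (trans (+-assoc (length B₁) (length B₂) _) (size cs))
      }
      where
      B₁#rest = All.tail (AllPairs.head (disjoint cs))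
      B₂#rest = AllPairs.head (AllPairs.tail (disjoint cs))
      rest#   = AllPairs.tail (AllPairs.tail (disjoint cs))
      conn₁ = All.head (connected cs)
      conn₂ = All.head (All.tail (connected cs))

      joined-cover : ∀ {v} → Any (v ∈ₗ_) (B₁ ∷ B₂ ∷ rest) → Any (v ∈ₗ_) ((B₁ ++ B₂) ∷ rest)
      joined-cover (here v∈)          = here (∈-++⁺ˡ v∈)
      joined-cover (there (here v∈))  = here (∈-++⁺ʳ B₁ v∈)
      joined-cover (there (there v∈)) = there v∈

      joined-connected : Connected ((x , y) ∷ G) (B₁ ++ B₂)
      joined-connected a∈ b∈ with ∈-++⁻ B₁ a∈ | ∈-++⁻ B₁ b∈
      ... | inj₁ a∈₁ | inj₁ b∈₁ = PathIn-mono ∈-++⁺ˡ (PathIn-weaken (conn₁ a∈₁ b∈₁))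
      ... | inj₂ a∈₂ | inj₂ b∈₂ = PathIn-mono (∈-++⁺ʳ B₁) (PathIn-weaken (conn₂ a∈₂ b∈₂))
      ... | inj₁ a∈₁ | inj₂ b∈₂ =
        PathIn-join B₁#B₂ (PathIn-weaken (conn₁ a∈₁ x∈)) (here (inj₁ (refl , refl))) (PathIn-weaken (conn₂ y∈ b∈₂))
      ... | inj₂ a∈₂ | inj₁ b∈₁ = PathIn-mono (∈-++-swap B₂) (PathIn-join (Disjoint-sym B₁#B₂)
        (PathIn-weaken (conn₂ a∈₂ y∈)) (here (inj₂ (refl , refl))) (PathIn-weaken (conn₁ x∈ b∈₁)))

      joined-internal : ∀ {a b} → Adj ((x , y) ∷ G) a b → Any (λ B → a ∈ₗ B × b ∈ₗ B) ((B₁ ++ B₂) ∷ rest)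
      joined-internal (here (inj₁ (refl , refl))) = here (∈-++⁺ˡ x∈ , ∈-++⁺ʳ B₁ y∈)
      joined-internal (here (inj₂ (refl , refl))) = here (∈-++⁺ʳ B₁ y∈ , ∈-++⁺ˡ x∈)
      joined-internal (there ab) with internal cs ab
      ... | here (a∈ , b∈)                = here (∈-++⁺ˡ a∈ , ∈-++⁺ˡ b∈)
      ... | there (here (a∈ , b∈))        = here (∈-++⁺ʳ B₁ a∈ , ∈-++⁺ʳ B₁ b∈)
      ... | there (there in-rest)         = there in-rest

      joined-loopless : Loopless ((x , y) ∷ G)
      joined-loopless v (here (inj₁ (x≡v , y≡v))) = x≢y (trans x≡v (sym y≡v))
      joined-loopless v (here (inj₂ (x≡v , y≡v))) = x≢y (trans x≡v (sym y≡v))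
      joined-loopless v (there vv)                = loopless cs v vv

two-components-not-terminal : ∀ {n} {G : Graph n} {B₁ B₂ rest} → Components G (B₁ ∷ B₂ ∷ rest) → ¬ Terminal G
two-components-not-terminal cs over with nonempty cs
... | (x , x∈) ∷ (y , y∈) ∷ _ = over (x , y) (join-move cs x∈ y∈)

singletons : ∀ n → List (Block n)
singletons n = map [_] (allFin n)

length-singletons : ∀ n → length (singletons n) ≡ n
length-singletons n = trans (length-map [_] (allFin n)) (length-tabulate id)

components-[] : ∀ {n} → Components {n} [] (singletons n)
components-[] {n} = record
  { cover     = λ v → Any.map⁺ (Any.map (λ v≡u → here v≡u) (∈-allFin v))
  ; disjoint  = AllPairs.map⁺ (AllPairs.map (λ u≢u′ → λ { (here refl , here refl) → u≢u′ refl })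
                                            (Unique.allFin⁺ n))
  ; unique    = All.map⁺ (All.universal (λ _ → [] ∷ []) (allFin n))
  ; nonempty  = All.map⁺ (All.universal (λ u → u , here refl) (allFin n))
  ; connected = All.map⁺ (All.universal (λ u → λ { (here refl) (here refl) → [] , [] ∷ [] , here refl ∷ [] })
                                        (allFin n))
  ; internal  = λ ()
  ; acyclic   = λ { (_ , _ ∷ _ , _ , _ , () ∷ _) }
  ; loopless  = λ _ ()
  ; size      = trans (sum-singletons (allFin n)) (length-tabulate id)
  }
  where
  sum-singletons : ∀ (vs : List (Fin n)) → sum (map length (map [_] vs)) ≡ length vs
  sum-singletons []       = refl
  sum-singletons (v ∷ vs) = cong suc (sum-singletons vs)

-- Strategies that maintain an invariant

module _ {n} (Inv : Graph n → List (Block n) → Set) where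

  data Join (G : Graph n) (bs : List (Block n)) : Set where
    join-by : ∀ B₁ B₂ rest {x y} → bs ↭ B₁ ∷ B₂ ∷ rest → x ∈ₗ B₁ → y ∈ₗ B₂ →
              Inv ((x , y) ∷ G) ((B₁ ++ B₂) ∷ rest) → Join G bs

-- Every move joins two components, so a position with c components ends after c - 1 moves.
module Strategy {n} (score : Graph n → ℕ) (me : Player) (Good : ℕ → Set)
  (Mine Theirs : Graph n → List (Block n) → Set)
  (mine-end   : ∀ {G B} → Components G (B ∷ []) → Mine G (B ∷ []) → Good (score G))
  (theirs-end : ∀ {G B} → Components G (B ∷ []) → Theirs G (B ∷ []) → Good (score G))
  (mine-step  : ∀ {G B₁ B₂ rest} → Components G (B₁ ∷ B₂ ∷ rest) → Mine G (B₁ ∷ B₂ ∷ rest) →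
                Join Theirs G (B₁ ∷ B₂ ∷ rest))
  (theirs-step : ∀ {G B₁ B₂ rest x y} → Components G (B₁ ∷ B₂ ∷ rest) → x ∈ₗ B₁ → y ∈ₗ B₂ →
                 Theirs G (B₁ ∷ B₂ ∷ rest) → Mine ((x , y) ∷ G) ((B₁ ++ B₂) ∷ rest))
  (Theirs-↭ : ∀ {G bs bs′} → bs ↭ bs′ → Theirs G bs → Theirs G bs′)
  where

  private
    F : Graph n → Player → Set
    F = Forces score me Good

    shorter : ∀ {B₁ B₂ : Block n} {rest bs r} → bs ↭ B₁ ∷ B₂ ∷ rest → length bs ≡ suc (suc r) →
              length ((B₁ ++ B₂) ∷ rest) ≡ suc r
    shorter bs↭ len = suc-injective (trans (sym (↭-length bs↭)) len)

    mine-by : ∀ r {G bs} → Components G bs → length bs ≡ suc r → Mine G bs → F G me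
    theirs-by : ∀ r {G bs} → Components G bs → length bs ≡ suc r → Theirs G bs → F G (other me)

    mine-by zero    {bs = B ∷ []} cs refl inv = stop (one-component-terminal cs) (mine-end cs inv)
    mine-by (suc r) {bs = B₁ ∷ B₂ ∷ rest} cs len inv with mine-step cs inv
    ... | join-by B₁′ B₂′ rest′ bs↭ x∈ y∈ inv′ =
      mine (join-move cs′ x∈ y∈) (theirs-by r (join-components cs′ x∈ y∈) (shorter bs↭ len) inv′)
      where cs′ = Components-↭ bs↭ cs

    theirs-by zero    {bs = B ∷ []} cs refl inv = stop (one-component-terminal cs) (theirs-end cs inv)
    theirs-by (suc r) {G} {bs = B₁ ∷ B₂ ∷ rest} cs len inv = theirs (two-components-not-terminal cs) reply
      where
      reply : ∀ e → Move G e → F (e ∷ G) me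
      reply (x , y) move with move-separates cs move
      ... | separated B₁′ B₂′ rest′ bs↭ x∈ y∈ =
        mine-by r (join-components cs′ x∈ y∈) (shorter bs↭ len) (theirs-step cs′ x∈ y∈ (Theirs-↭ bs↭ inv))
        where cs′ = Components-↭ bs↭ cs

  forces-mine : ∀ {G B bs} → Components G (B ∷ bs) → Mine G (B ∷ bs) → F G me
  forces-mine cs = mine-by _ cs refl

  forces-theirs : ∀ {G B bs} → Components G (B ∷ bs) → Theirs G (B ∷ bs) → F G (other me)
  forces-theirs cs = theirs-by _ cs refl

-- The lower bound: Max builds a star

stars-at≤starScore : ∀ {n} k (G : Graph n) → Loopless G → ∀ c → deg G c C (k ∸ 1) ≤ starScore k G
stars-at≤starScore k G loopless c =
  subst (deg G c C (k ∸ 1) ≤_) (sym (starScore≡∑deg k G loopless)) (f≤∑f (λ v → deg G v C (k ∸ 1)) c)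

module StarBuilding (n k : ℕ) where

  Ahead : ℕ → Graph n → Set
  Ahead t G = ∃ λ c → ⌊ n /2⌋ ≤ deg G c + t

  -- With L components left Max still makes ⌊L/2⌋ moves on his turn and ⌊(L-1)/2⌋ on Mini's.
  MaxToMove MiniToMove : Graph n → List (Block n) → Set
  MaxToMove  G bs = Ahead ⌊ length bs /2⌋ G
  MiniToMove G bs = Ahead ⌊ pred (length bs) /2⌋ G

  Good : ℕ → Set
  Good s = (n / 2) C (k ∸ 1) ≤ s

  good-at-end : ∀ {G B} → Components G (B ∷ []) → Ahead 0 G → Good (starScore k G)
  good-at-end {G} cs (c , ⌊n/2⌋≤) = begin
    (n / 2) C (k ∸ 1)  ≡⟨ cong (_C (k ∸ 1)) (sym (⌊n/2⌋≡n/2 n)) ⟩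
    ⌊ n /2⌋ C (k ∸ 1)  ≤⟨ C-monoˡ (k ∸ 1) (subst (⌊ n /2⌋ ≤_) (+-identityʳ _) ⌊n/2⌋≤) ⟩
    deg G c C (k ∸ 1)  ≤⟨ stars-at≤starScore k G (loopless cs) c ⟩
    starScore k G      ∎
    where open ≤-Reasoning

  extend-star : ∀ {G B₁ B₂ rest} → Components G (B₁ ∷ B₂ ∷ rest) → MaxToMove G (B₁ ∷ B₂ ∷ rest) →
                Join MiniToMove G (B₁ ∷ B₂ ∷ rest)
  extend-star {G} {rest = rest} cs (c , ahead) with extract (cover cs c)
  ... | B , [] , bs↭ , _ = ⊥-elim (case ↭-length bs↭ of λ ())
  ... | B , B′ ∷ rest′ , bs↭ , c∈ with All.lookup (nonempty (Components-↭ bs↭ cs)) (there (here refl))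
  ...   | w , w∈ = join-by B B′ rest′ bs↭ c∈ w∈ (c , ahead′)
    where
    move = join-move (Components-↭ bs↭ cs) c∈ w∈
    same-length : length rest ≡ length rest′
    same-length = suc-injective (suc-injective (↭-length bs↭))
    ahead′ : ⌊ n /2⌋ ≤ deg ((c , w) ∷ G) c + ⌊ length rest′ /2⌋
    ahead′ = begin
      ⌊ n /2⌋                                   ≤⟨ ahead ⟩
      deg G c + suc ⌊ length rest /2⌋           ≡⟨ +-suc _ _ ⟩
      suc (deg G c) + ⌊ length rest /2⌋          ≡⟨ cong₂ _+_ (sym (deg-∷-left (proj₁ move) (proj₁ (proj₂ move))))
                                                              (cong ⌊_/2⌋ same-length) ⟩
      deg ((c , w) ∷ G) c + ⌊ length rest′ /2⌋  ∎
      where open ≤-Reasoning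

  keep-star : ∀ {G B₁ B₂ rest x y} → Components G (B₁ ∷ B₂ ∷ rest) → x ∈ₗ B₁ → y ∈ₗ B₂ →
              MiniToMove G (B₁ ∷ B₂ ∷ rest) → MaxToMove ((x , y) ∷ G) ((B₁ ++ B₂) ∷ rest)
  keep-star {x = x} {y} _ _ _ (c , ahead) = c , ≤-trans ahead (+-monoˡ-≤ _ (deg-∷-≤ (x , y) c))

  MiniToMove-↭ : ∀ {G bs bs′} → bs ↭ bs′ → MiniToMove G bs → MiniToMove G bs′
  MiniToMove-↭ bs↭ = subst (λ L → Ahead ⌊ pred L /2⌋ _) (↭-length bs↭)

  open Strategy (starScore k) Max Good MaxToMove MiniToMove
                good-at-end good-at-end extend-star keep-star MiniToMove-↭ public

lower-bound : ∀ n k → 1 < k → (first : Player) → LowerBound n k first ((n / 2) C (k ∸ 1))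
lower-bound zero k 1<k first = stop (λ { (() , _) }) (subst (_≤ 0) (sym (k>n⇒nCk≡0 (∸-monoˡ-< 1<k (s≤s z≤n)))) z≤n)
lower-bound (suc n) k _ Max = forces-mine components-[] (0F , bound)
  where
  open StarBuilding (suc n) k
  bound : ⌊ suc n /2⌋ ≤ deg {suc n} [] 0F + ⌊ length (singletons (suc n)) /2⌋
  bound = ≤-reflexive (sym (cong₂ (λ d L → d + ⌊ L /2⌋) (deg-[] {suc n} 0F) (length-singletons (suc n))))
lower-bound 1 k _ Mini = forces-theirs components-[] (0F , z≤n)
  where open StarBuilding 1 k
lower-bound (suc (suc n)) k _ Mini = theirs (two-components-not-terminal components-[]) reply
  where
  open StarBuilding (suc (suc n)) k
  reply : ∀ e → Move [] e → Forces (starScore k) Max Good (e ∷ []) Max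
  reply (x , y) move with move-separates components-[] move
  ... | separated B₁ B₂ rest bs↭ x∈ y∈ = forces-mine (join-components cs′ x∈ y∈) (x , bound)
    where
    cs′ = Components-↭ bs↭ components-[]
    move′ = join-move cs′ x∈ y∈
    length-rest : length rest ≡ n
    length-rest = suc-injective (suc-injective (trans (sym (↭-length bs↭)) (length-singletons (suc (suc n)))))
    bound : ⌊ suc (suc n) /2⌋ ≤ deg ((x , y) ∷ []) x + ⌊ length ((B₁ ++ B₂) ∷ rest) /2⌋
    bound = begin
      suc ⌊ n /2⌋                                     ≤⟨ s≤s (⌊n/2⌋-mono (n≤1+n n)) ⟩
      suc ⌊ suc n /2⌋                                 ≡⟨ cong₂ (λ d L → d + ⌊ suc L /2⌋) deg-x (sym length-rest) ⟩
      deg ((x , y) ∷ []) x + ⌊ suc (length rest) /2⌋  ∎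
      where
      open ≤-Reasoning
      deg-x : 1 ≡ deg ((x , y) ∷ []) x
      deg-x = sym (trans (deg-∷-left (proj₁ move′) (proj₁ (proj₂ move′))) (cong suc (deg-[] x)))

-- Block kinds and the census of a partition

data Kind : Set where
  single pair big : Kind

kind : ℕ → Kind
kind 1 = single
kind 2 = pair
kind _ = big   -- kind 0 never occurs: components are nonempty

kind-≥3 : ∀ {s} → 3 ≤ s → kind s ≡ big
kind-≥3 (s≤s (s≤s (s≤s _))) = refl

_⋈_ : Kind → Kind → Kind
single ⋈ single = pair
_      ⋈ _      = big

kind-+ : ∀ {s₁ s₂} → 1 ≤ s₁ → 1 ≤ s₂ → kind (s₁ + s₂) ≡ kind s₁ ⋈ kind s₂
kind-+ {1}                   {1}                   _ _ = refl
kind-+ {1}                   {2}                   _ _ = refl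
kind-+ {1}                   {suc (suc (suc _))}   _ _ = refl
kind-+ {2}                   {suc _}               _ _ = refl
kind-+ {suc (suc (suc _))}   {_}                   _ _ = refl

isBig : Kind → ℕ
isBig big = 1
isBig _   = 0

weight : Kind → ℕ
weight big = 3
weight _   = 1

record Census : Set where
  constructor ⟨_,_,_⟩
  field singles pairs bigs : ℕ

infixl 6 _⊕_
_⊕_ : Census → Kind → Census
⟨ i , p , t ⟩ ⊕ single = ⟨ suc i , p , t ⟩
⟨ i , p , t ⟩ ⊕ pair   = ⟨ i , suc p , t ⟩
⟨ i , p , t ⟩ ⊕ big    = ⟨ i , p , suc t ⟩

⊕-comm : ∀ c κ κ′ → c ⊕ κ ⊕ κ′ ≡ c ⊕ κ′ ⊕ κ
⊕-comm _ single single = refl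
⊕-comm _ single pair   = refl
⊕-comm _ single big    = refl
⊕-comm _ pair   single = refl
⊕-comm _ pair   pair   = refl
⊕-comm _ pair   big    = refl
⊕-comm _ big    single = refl
⊕-comm _ big    pair   = refl
⊕-comm _ big    big    = refl

⊕-cancel : ∀ {c c′} κ → c ⊕ κ ≡ c′ ⊕ κ → c ≡ c′
⊕-cancel single refl = refl
⊕-cancel pair   refl = refl
⊕-cancel big    refl = refl

⊕-diamond : ∀ {c c′ κ κ′} → κ ≢ κ′ → c ⊕ κ ≡ c′ ⊕ κ′ → ∃ λ d → c ≡ d ⊕ κ′ × c′ ≡ d ⊕ κ
⊕-diamond {κ = single} {single} κ≢κ′ _    = ⊥-elim (κ≢κ′ refl)
⊕-diamond {κ = single} {pair}   _    refl = _ , refl , refl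
⊕-diamond {κ = single} {big}    _    refl = _ , refl , refl
⊕-diamond {κ = pair}   {single} _    refl = _ , refl , refl
⊕-diamond {κ = pair}   {pair}   κ≢κ′ _    = ⊥-elim (κ≢κ′ refl)
⊕-diamond {κ = pair}   {big}    _    refl = _ , refl , refl
⊕-diamond {κ = big}    {single} _    refl = _ , refl , refl
⊕-diamond {κ = big}    {pair}   _    refl = _ , refl , refl
⊕-diamond {κ = big}    {big}    κ≢κ′ _    = ⊥-elim (κ≢κ′ refl)

_≟ᵏ_ : (κ κ′ : Kind) → Dec (κ ≡ κ′)
single ≟ᵏ single = yes refl
pair   ≟ᵏ pair   = yes refl
big    ≟ᵏ big    = yes refl
single ≟ᵏ pair   = no λ ()
single ≟ᵏ big    = no λ ()
pair   ≟ᵏ single = no λ ()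
pair   ≟ᵏ big    = no λ ()
big    ≟ᵏ single = no λ ()
big    ≟ᵏ pair   = no λ ()

total : Census → ℕ
total ⟨ i , p , t ⟩ = i + p + t

total-⊕ : ∀ c κ → total (c ⊕ κ) ≡ suc (total c)
total-⊕ ⟨ i , p , t ⟩ single = refl
total-⊕ ⟨ i , p , t ⟩ pair   = cong (_+ t) (+-suc i p)
total-⊕ ⟨ i , p , t ⟩ big    = +-suc (i + p) t

load : Census → ℕ
load ⟨ i , p , t ⟩ = i + p + 3 * t

load-⊕ : ∀ c κ → load (c ⊕ κ) ≡ weight κ + load c
load-⊕ ⟨ i , p , t ⟩ single = refl
load-⊕ ⟨ i , p , t ⟩ pair   = cong (_+ 3 * t) (+-suc i p)
load-⊕ ⟨ i , p , t ⟩ big    = trans (cong (i + p +_) (*-suc 3 t)) (x∙yz≈y∙xz (i + p) 3 (3 * t))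

census : ∀ {n} → List (Block n) → Census
census []       = ⟨ 0 , 0 , 0 ⟩
census (B ∷ bs) = census bs ⊕ kind (length B)

census-↭ : ∀ {n} {bs bs′ : List (Block n)} → bs ↭ bs′ → census bs ≡ census bs′
census-↭ ↭.refl                 = refl
census-↭ (↭.prep B bs↭)         = cong (_⊕ kind (length B)) (census-↭ bs↭)
census-↭ (↭.swap {xs} B B′ bs↭) =
  trans (⊕-comm (census xs) (kind (length B′)) (kind (length B)))
        (cong (λ c → c ⊕ kind (length B) ⊕ kind (length B′)) (census-↭ bs↭))
census-↭ (↭.trans bs↭ bs↭′)     = trans (census-↭ bs↭) (census-↭ bs↭′)

find-kind : ∀ {n} (bs : List (Block n)) {c} κ → census bs ≡ c ⊕ κ →
            ∃ λ B → ∃ λ rest → bs ↭ B ∷ rest × kind (length B) ≡ κ × census rest ≡ c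
find-kind [] single ()
find-kind [] pair   ()
find-kind [] big    ()
find-kind (B ∷ bs) κ eq with kind (length B) ≟ᵏ κ
... | yes refl = B , bs , ↭.refl , refl , ⊕-cancel κ eq
... | no  κ′≢κ with ⊕-diamond κ′≢κ eq
...   | d , bs≡ , c≡ with find-kind bs κ bs≡
...     | B′ , rest , bs↭ , κ≡ , rest≡ =
  B′ , B ∷ rest , ↭.trans (↭.prep B bs↭) (↭.swap B B′ ↭.refl) , κ≡ , trans (cong (_⊕ _) rest≡) (sym c≡)

census-singletons : ∀ n → census (singletons n) ≡ ⟨ n , 0 , 0 ⟩
census-singletons n = trans (go (allFin n)) (cong ⟨_, 0 , 0 ⟩ (length-tabulate id))
  where
  go : ∀ (vs : List (Fin n)) → census (map [_] vs) ≡ ⟨ length vs , 0 , 0 ⟩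
  go []       = refl
  go (v ∷ vs) = cong (_⊕ single) (go vs)

2≤total : ∀ {n} (B₁ B₂ : Block n) rest → 2 ≤ total (census (B₁ ∷ B₂ ∷ rest))
2≤total B₁ B₂ rest = subst (2 ≤_) (sym (trans (total-⊕ (census rest ⊕ kind (length B₂)) (kind (length B₁)))
                                              (cong suc (total-⊕ (census rest) (kind (length B₂))))))
                           (s≤s (s≤s z≤n))

load-⊕⊕ : ∀ c κ₁ κ₂ → load (c ⊕ κ₂ ⊕ κ₁) ≡ weight κ₁ + (weight κ₂ + load c)
load-⊕⊕ c κ₁ κ₂ = trans (load-⊕ (c ⊕ κ₂) κ₁) (cong (weight κ₁ +_) (load-⊕ c κ₂))

census-join : ∀ {n} {B₁ B₂ : Block n} rest → ∃ (_∈ₗ B₁) → ∃ (_∈ₗ B₂) →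
              census ((B₁ ++ B₂) ∷ rest) ≡ census rest ⊕ (kind (length B₁) ⋈ kind (length B₂))
census-join {n} {B₁} rest ne₁ ne₂ =
  cong (census rest ⊕_) (trans (cong kind (length-++ B₁)) (kind-+ (1≤length ne₁) (1≤length ne₂)))
  where
  1≤length : ∀ {B : Block n} → ∃ (_∈ₗ B) → 1 ≤ length B
  1≤length {_ ∷ _} _ = s≤s z≤n

-- Max's turn may start one short: in the opening (only singletons) and after Mini's last move.
bonus : Census → ℕ
bonus ⟨ _     , suc _ , _           ⟩ = 0
bonus ⟨ _     , 0     , 0           ⟩ = 1
bonus ⟨ _     , 0     , suc (suc _) ⟩ = 0
bonus ⟨ 0     , 0     , 1           ⟩ = 1
bonus ⟨ suc _ , 0     , 1           ⟩ = 0

-- Without a big component and with at most one singleton, Mini must join a pair, which raises the load.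
debt : Census → ℕ
debt ⟨ _           , _ , suc _ ⟩ = 0
debt ⟨ suc (suc _) , _ , 0     ⟩ = 0
debt ⟨ _           , p , 0     ⟩ = 2 ⊓ p

bonus≤1 : ∀ c → bonus c ≤ 1
bonus≤1 ⟨ _     , suc _ , _           ⟩ = z≤n
bonus≤1 ⟨ _     , 0     , 0           ⟩ = ≤-refl
bonus≤1 ⟨ _     , 0     , suc (suc _) ⟩ = z≤n
bonus≤1 ⟨ 0     , 0     , 1           ⟩ = ≤-refl
bonus≤1 ⟨ suc _ , 0     , 1           ⟩ = z≤n

-- In each case below both sides evaluate to numerals once enough of the census is known.
max-gain : ∀ c κ₁ κ₂ → 2 * (isBig κ₁ + isBig κ₂) + weight (κ₁ ⋈ κ₂) + debt (c ⊕ (κ₁ ⋈ κ₂)) + bonus (c ⊕ κ₂ ⊕ κ₁)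
                       ≤ weight κ₁ + weight κ₂ + 1
max-gain _                         single pair   = ≤-refl
max-gain _                         pair   single = ≤-refl
max-gain _                         pair   pair   = ≤-refl
max-gain _                         pair   big    = ≤-refl
max-gain _                         big    pair   = ≤-refl
max-gain ⟨ _ , suc _ , suc _ ⟩       single single = ≤ᵇ⇒≤ _ _ _
max-gain ⟨ _ , 0 , 1 ⟩               single single = ≤ᵇ⇒≤ _ _ _
max-gain ⟨ _ , 0 , suc (suc _) ⟩     single single = ≤ᵇ⇒≤ _ _ _
max-gain ⟨ suc (suc _) , suc _ , 0 ⟩ single single = ≤ᵇ⇒≤ _ _ _
max-gain ⟨ suc (suc _) , 0 , 0 ⟩     single single = ≤ᵇ⇒≤ _ _ _
max-gain ⟨ 0 , suc _ , 0 ⟩           single single = ≤ᵇ⇒≤ _ _ _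
max-gain ⟨ 0 , 0 , 0 ⟩               single single = ≤ᵇ⇒≤ _ _ _
max-gain ⟨ 1 , suc _ , 0 ⟩           single single = ≤ᵇ⇒≤ _ _ _
max-gain ⟨ 1 , 0 , 0 ⟩               single single = ≤ᵇ⇒≤ _ _ _
max-gain ⟨ _ , suc _ , _ ⟩           single big    = ≤ᵇ⇒≤ _ _ _
max-gain ⟨ _ , 0 , 0 ⟩               single big    = ≤ᵇ⇒≤ _ _ _
max-gain ⟨ _ , 0 , suc _ ⟩           single big    = ≤ᵇ⇒≤ _ _ _
max-gain ⟨ _ , suc _ , _ ⟩           big    single = ≤ᵇ⇒≤ _ _ _
max-gain ⟨ _ , 0 , 0 ⟩               big    single = ≤ᵇ⇒≤ _ _ _
max-gain ⟨ _ , 0 , suc _ ⟩           big    single = ≤ᵇ⇒≤ _ _ _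
max-gain ⟨ _ , suc _ , _ ⟩           big    big    = ≤ᵇ⇒≤ _ _ _
max-gain ⟨ _ , 0 , _ ⟩               big    big    = ≤ᵇ⇒≤ _ _ _

MiniGain : Census → Kind → Kind → Set
MiniGain c κ₁ κ₂ = weight (κ₁ ⋈ κ₂) + 1 ≤ weight κ₁ + weight κ₂ + debt (c ⊕ κ₂ ⊕ κ₁) + bonus (c ⊕ (κ₁ ⋈ κ₂))

mini-choice : ∀ c → 2 ≤ total c → ∃ λ c′ → ∃ λ κ₁ → ∃ λ κ₂ → c ≡ c′ ⊕ κ₂ ⊕ κ₁ × MiniGain c′ κ₁ κ₂
mini-choice ⟨ suc (suc i) , p , t ⟩ _ = ⟨ i , p , t ⟩ , single , single , refl , ≤ᵇ⇒≤ _ _ _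
mini-choice ⟨ i , p , suc (suc t) ⟩ _ = ⟨ i , p , t ⟩ , big , big , refl , ≤ᵇ⇒≤ _ _ _
mini-choice ⟨ 1 , p , 1 ⟩           _ = ⟨ 0 , p , 0 ⟩ , single , big , refl , ≤ᵇ⇒≤ _ _ _
mini-choice ⟨ 0 , suc p , 1 ⟩       _ = ⟨ 0 , p , 0 ⟩ , pair , big , refl , ≤ᵇ⇒≤ _ _ _
mini-choice ⟨ 1 , 1 , 0 ⟩           _ = ⟨ 0 , 0 , 0 ⟩ , single , pair , refl , ≤ᵇ⇒≤ _ _ _
mini-choice ⟨ 1 , suc (suc p) , 0 ⟩ _ = ⟨ 0 , suc p , 0 ⟩ , single , pair , refl , ≤ᵇ⇒≤ _ _ _
mini-choice ⟨ 0 , suc (suc p) , 0 ⟩ _ = ⟨ 0 , p , 0 ⟩ , pair , pair , refl , ≤ᵇ⇒≤ _ _ _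
mini-choice ⟨ 0 , 0 , 0 ⟩ ()
mini-choice ⟨ 1 , 0 , 0 ⟩ (s≤s ())
mini-choice ⟨ 0 , 1 , 0 ⟩ (s≤s ())
mini-choice ⟨ 0 , 0 , 1 ⟩ (s≤s ())

max-glue : ∀ {X X′ Δ L W₁ W₂ w d b N} → X′ ≤ X + Δ → 2 * Δ + w + d + b ≤ W₁ + W₂ + 1 →
           2 * X + (W₁ + (W₂ + L)) + 1 ≤ N + b → 2 * X′ + (w + L) + d ≤ N
max-glue {X} {X′} {Δ} {L} {W₁} {W₂} {w} {d} {b} {N} X′≤ gain before = +-cancelʳ-≤ b _ _ (begin
  2 * X′ + (w + L) + d + b        ≤⟨ +-monoˡ-≤ b (+-monoˡ-≤ d (+-monoˡ-≤ (w + L) (*-monoʳ-≤ 2 X′≤))) ⟩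
  2 * (X + Δ) + (w + L) + d + b   ≡⟨ regroup X Δ L w d b ⟩
  2 * X + L + (2 * Δ + w + d + b) ≤⟨ +-monoʳ-≤ (2 * X + L) gain ⟩
  2 * X + L + (W₁ + W₂ + 1)       ≡⟨ regroup′ X L W₁ W₂ ⟩
  2 * X + (W₁ + (W₂ + L)) + 1     ≤⟨ before ⟩
  N + b                           ∎)
  where
  open ≤-Reasoning
  regroup : ∀ X Δ L w d b → 2 * (X + Δ) + (w + L) + d + b ≡ 2 * X + L + (2 * Δ + w + d + b)
  regroup = solve-∀
  regroup′ : ∀ X L W₁ W₂ → 2 * X + L + (W₁ + W₂ + 1) ≡ 2 * X + (W₁ + (W₂ + L)) + 1
  regroup′ = solve-∀

mini-glue : ∀ {X X′ L W₁ W₂ w d b N} → X′ ≤ X → w + 1 ≤ W₁ + W₂ + d + b →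
            2 * X + (W₁ + (W₂ + L)) + d ≤ N → 2 * X′ + (w + L) + 1 ≤ N + b
mini-glue {X} {X′} {L} {W₁} {W₂} {w} {d} {b} {N} X′≤ gain before = begin
  2 * X′ + (w + L) + 1             ≤⟨ +-monoˡ-≤ 1 (+-monoˡ-≤ (w + L) (*-monoʳ-≤ 2 X′≤)) ⟩
  2 * X + (w + L) + 1              ≡⟨ regroup X L w ⟩
  2 * X + L + (w + 1)              ≤⟨ +-monoʳ-≤ (2 * X + L) gain ⟩
  2 * X + L + (W₁ + W₂ + d + b)    ≡⟨ regroup′ X L W₁ W₂ d b ⟩
  2 * X + (W₁ + (W₂ + L)) + d + b  ≤⟨ +-monoˡ-≤ b before ⟩
  N + b                            ∎
  where
  open ≤-Reasoning
  regroup : ∀ X L w → 2 * X + (w + L) + 1 ≡ 2 * X + L + (w + 1)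
  regroup = solve-∀
  regroup′ : ∀ X L W₁ W₂ d b → 2 * X + L + (W₁ + W₂ + d + b) ≡ 2 * X + (W₁ + (W₂ + L)) + d + b
  regroup′ = solve-∀

[2+X]Ck≤⌈n/2⌉Ck : ∀ {k} → 3 ≤ k → ∀ {n X} → 2 * X + weight (kind n) ≤ n → (2 + X) C k ≤ ⌈ n /2⌉ C k
[2+X]Ck≤⌈n/2⌉Ck 3≤k {0} {X} h = ⊥-elim (case ≤-trans (m≤n+m 3 (2 * X)) h of λ ())
[2+X]Ck≤⌈n/2⌉Ck {k} 3≤k {1} {X} h with 2*m+1≤2⇒m≡0 {X} (m≤n⇒m≤1+n h)
... | refl = subst (_≤ ⌈ 1 /2⌉ C k) (sym (k>n⇒nCk≡0 3≤k)) z≤n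
[2+X]Ck≤⌈n/2⌉Ck {k} 3≤k {2} {X} h with 2*m+1≤2⇒m≡0 {X} h
... | refl = subst (_≤ ⌈ 2 /2⌉ C k) (sym (k>n⇒nCk≡0 3≤k)) z≤n
[2+X]Ck≤⌈n/2⌉Ck {k} 3≤k {suc (suc (suc n))} {X} h = begin
  (2 + X) C k                  ≤⟨ C-monoˡ k (s≤s (s≤s (2*m≤n⇒m≤⌊n/2⌋ 2X≤n))) ⟩
  ⌊ 4 + n /2⌋ C k              ≡⟨ cong (_C k) (trans (⌊n/2⌋≡n/2 (4 + n)) (cong (_/ 2) (+-comm 1 (3 + n)))) ⟩
  ⌈ 3 + n /2⌉ C k              ∎
  where
  open ≤-Reasoning
  2X≤n : 2 * X ≤ n
  2X≤n = +-cancelʳ-≤ 3 _ _ (subst (2 * X + 3 ≤_) (+-comm 3 n) h)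

-- Excess degree and tidy components

excess : ∀ {n} → Graph n → ℕ
excess G = ∑ (λ v → deg G v ∸ 2)

excess-[] : ∀ {n} → excess {n} [] ≡ 0
excess-[] {n} = trans (cong sum (tabulate-cong {n = n} (λ v → cong (_∸ 2) (deg-[] v)))) (∑-zero n)

[1+d]∸2≤1+[d∸2] : ∀ d → suc d ∸ 2 ≤ 1 + (d ∸ 2)
[1+d]∸2≤1+[d∸2] 0             = z≤n
[1+d]∸2≤1+[d∸2] 1             = z≤n
[1+d]∸2≤1+[d∸2] (suc (suc d)) = ≤-refl

d≤1⇒[1+d]∸2≤m : ∀ {d} → d ≤ 1 → ∀ m → suc d ∸ 2 ≤ m
d≤1⇒[1+d]∸2≤m z≤n       _ = z≤n
d≤1⇒[1+d]∸2≤m (s≤s z≤n) _ = z≤n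

module _ {n} {G : Graph n} {x y : Fin n} (x≢y : x ≢ y) (¬xy : ¬ Adj G x y) where

  excess-∷ : ∀ a b → suc (deg G x) ∸ 2 ≤ a + (deg G x ∸ 2) → suc (deg G y) ∸ 2 ≤ b + (deg G y ∸ 2) →
             excess ((x , y) ∷ G) ≤ excess G + (a + b)
  excess-∷ a b x-grows y-grows = begin
    excess ((x , y) ∷ G)                          ≤⟨ ∑-mono bound ⟩
    ∑ (updateAt (updateAt e y (b +_)) x (a +_))   ≡⟨ ∑-updateAt (updateAt e y (b +_)) x a ⟩
    a + ∑ (updateAt e y (b +_))                   ≡⟨ cong (a +_) (∑-updateAt e y b) ⟩
    a + (b + excess G)                            ≡⟨ sym (+-assoc a b (excess G)) ⟩
    a + b + excess G                              ≡⟨ +-comm (a + b) (excess G) ⟩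
    excess G + (a + b)                            ∎
    where
    open ≤-Reasoning
    e = λ v → deg G v ∸ 2
    bound : ∀ v → deg ((x , y) ∷ G) v ∸ 2 ≤ updateAt (updateAt e y (b +_)) x (a +_) v
    bound v with v ≟ᶠ x | v ≟ᶠ y
    ... | yes refl | _        rewrite updateAt-updates v {a +_} (updateAt e y (b +_))
                                    | updateAt-minimal v y {b +_} e x≢y
                                    | deg-∷-left x≢y ¬xy = x-grows
    ... | no v≢x   | yes refl rewrite updateAt-minimal v x {a +_} (updateAt e y (b +_)) v≢x
                                    | updateAt-updates v {b +_} e
                                    | deg-∷-right x≢y ¬xy = y-grows
    ... | no v≢x   | no v≢y   rewrite updateAt-minimal v x {a +_} (updateAt e y (b +_)) v≢x
                                    | updateAt-minimal v y {b +_} e v≢y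
                                    | deg-∷-other x≢y ¬xy v≢x v≢y = ≤-refl

Leaf : ∀ {n} → Graph n → Fin n → Set
Leaf G v = deg G v ≤ 1

HasLeaf : ∀ {n} → Graph n → Block n → Set
HasLeaf G B = ∃ λ l → l ∈ₗ B × Leaf G l

-- Big components keep two distinct leaves, so Mini can always join two components at leaves.
TidyAs : ∀ {n} → Kind → Graph n → Block n → Set
TidyAs single G B = All (λ v → deg G v ≡ 0) B
TidyAs pair   G B = All (Leaf G) B
TidyAs big    G B = ∃ λ l₁ → ∃ λ l₂ → l₁ ≢ l₂ × (l₁ ∈ₗ B × Leaf G l₁) × (l₂ ∈ₗ B × Leaf G l₂)

Tidy : ∀ {n} → Graph n → Block n → Set
Tidy G B = TidyAs (kind (length B)) G B

module _ {n} {G G′ : Graph n} where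

  TidyAs-transport : ∀ κ {B} → (∀ {v} → v ∈ₗ B → deg G′ v ≡ deg G v) → TidyAs κ G B → TidyAs κ G′ B
  TidyAs-transport single same tidy = All.tabulate λ v∈ → trans (same v∈) (All.lookup tidy v∈)
  TidyAs-transport pair   same tidy = All.tabulate λ v∈ → subst (_≤ 1) (sym (same v∈)) (All.lookup tidy v∈)
  TidyAs-transport big    same (l₁ , l₂ , l₁≢l₂ , (l₁∈ , leaf₁) , (l₂∈ , leaf₂)) =
    l₁ , l₂ , l₁≢l₂ , (l₁∈ , subst (_≤ 1) (sym (same l₁∈)) leaf₁) , (l₂∈ , subst (_≤ 1) (sym (same l₂∈)) leaf₂)

  leaf-after-edge : ∀ {B z} → Tidy G B → Unique B → z ∈ₗ B → deg G′ z ≡ suc (deg G z) →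
                    (∀ {v} → v ∈ₗ B → v ≢ z → deg G′ v ≡ deg G v) → HasLeaf G′ B
  leaf-after-edge {u ∷ []} (d≡0 ∷ []) _ (here refl) dz _ = u , here refl , ≤-reflexive (trans dz (cong suc d≡0))
  leaf-after-edge {u ∷ u′ ∷ []} (_ ∷ leaf′ ∷ []) ((u≢u′ ∷ []) ∷ _) (here refl) _ same =
    u′ , there (here refl) , subst (_≤ 1) (sym (same (there (here refl)) (u≢u′ ∘ sym))) leaf′
  leaf-after-edge {u ∷ u′ ∷ []} (leaf ∷ _ ∷ []) ((u≢u′ ∷ []) ∷ _) (there (here refl)) _ same =
    u , here refl , subst (_≤ 1) (sym (same (here refl) u≢u′)) leaf
  leaf-after-edge {_ ∷ _ ∷ _ ∷ _} {z} (l₁ , l₂ , l₁≢l₂ , (l₁∈ , leaf₁) , (l₂∈ , leaf₂)) _ _ _ same with l₁ ≟ᶠ z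
  ... | yes refl = l₂ , l₂∈ , subst (_≤ 1) (sym (same l₂∈ (l₁≢l₂ ∘ sym))) leaf₂
  ... | no l₁≢z  = l₁ , l₁∈ , subst (_≤ 1) (sym (same l₁∈ l₁≢z)) leaf₁

has-leaf : ∀ {n} {G : Graph n} {B} → Tidy G B → ∃ (_∈ₗ B) → HasLeaf G B
has-leaf {B = u ∷ []}          (d≡0 ∷ [])  _ = u , here refl , subst (_≤ 1) (sym d≡0) z≤n
has-leaf {B = u ∷ u′ ∷ []}     (leaf ∷ _)  _ = u , here refl , leaf
has-leaf {B = _ ∷ _ ∷ _ ∷ _}   (l₁ , _ , _ , (l₁∈ , leaf₁) , _) _ = l₁ , l₁∈ , leaf₁

excess-growth : ∀ {n} {G : Graph n} {B v} → Tidy G B → v ∈ₗ B →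
                suc (deg G v) ∸ 2 ≤ isBig (kind (length B)) + (deg G v ∸ 2)
excess-growth {B = u ∷ []}        (d≡0 ∷ []) (here refl) = d≤1⇒[1+d]∸2≤m (subst (_≤ 1) (sym d≡0) z≤n) _
excess-growth {B = u ∷ u′ ∷ []}   leaves     v∈          = d≤1⇒[1+d]∸2≤m (All.lookup leaves v∈) _
excess-growth {G = G} {B = _ ∷ _ ∷ _ ∷ _} {v} _ _ = [1+d]∸2≤1+[d∸2] (deg G v)

two-leaves : ∀ {n} {G : Graph n} {B₁ B₂} → Disjoint B₁ B₂ → HasLeaf G B₁ → HasLeaf G B₂ → TidyAs big G (B₁ ++ B₂)
two-leaves {B₁ = B₁} B₁#B₂ (l₁ , l₁∈ , leaf₁) (l₂ , l₂∈ , leaf₂) =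
  l₁ , l₂ , (λ { refl → B₁#B₂ (l₁∈ , l₂∈) }) , (∈-++⁺ˡ l₁∈ , leaf₁) , (∈-++⁺ʳ B₁ l₂∈ , leaf₂)

joined-tidy : ∀ {n} {G : Graph n} B₁ B₂ → Disjoint B₁ B₂ → HasLeaf G B₁ → HasLeaf G B₂ → Tidy G (B₁ ++ B₂)
joined-tidy (u ∷ []) (u′ ∷ []) _ (_ , here refl , leaf) (_ , here refl , leaf′) = leaf ∷ leaf′ ∷ []
joined-tidy (u ∷ []) (_ ∷ _ ∷ _) B₁#B₂ leaf₁ leaf₂ = two-leaves B₁#B₂ leaf₁ leaf₂
joined-tidy {G = G} (u ∷ u′ ∷ r) (w ∷ r′) B₁#B₂ leaf₁ leaf₂ =
  subst (λ κ → TidyAs κ G (u ∷ u′ ∷ r ++ w ∷ r′)) (sym (kind-≥3 (s≤s (s≤s 1≤length))))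
        (two-leaves B₁#B₂ leaf₁ leaf₂)
  where
  1≤length : 1 ≤ length (r ++ w ∷ r′)
  1≤length = subst (1 ≤_) (sym (length-++ r)) (≤-trans (s≤s z≤n) (m≤n+m _ (length r)))

module _ {n} {G : Graph n} {B₁ B₂ rest} (cs : Components G (B₁ ∷ B₂ ∷ rest))
         {x y} (x∈ : x ∈ₗ B₁) (y∈ : y ∈ₗ B₂) where

  private
    G′ = (x , y) ∷ G
    x≢y = proj₁ (join-move cs x∈ y∈)
    ¬xy = proj₁ (proj₂ (join-move cs x∈ y∈))
    B₁#B₂ = All.head (AllPairs.head (disjoint cs))

    unchanged : ∀ {v} → v ≢ x → v ≢ y → deg G′ v ≡ deg G v
    unchanged = deg-∷-other x≢y ¬xy

    leaf₁ : Tidy G B₁ → HasLeaf G′ B₁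
    leaf₁ tidy = leaf-after-edge tidy (All.head (unique cs)) x∈ (deg-∷-left x≢y ¬xy)
                   λ v∈ v≢x → unchanged v≢x λ { refl → B₁#B₂ (v∈ , y∈) }

    leaf₂ : Tidy G B₂ → HasLeaf G′ B₂
    leaf₂ tidy = leaf-after-edge tidy (All.head (All.tail (unique cs))) y∈ (deg-∷-right x≢y ¬xy)
                   λ v∈ v≢y → unchanged (λ { refl → B₁#B₂ (x∈ , v∈) }) v≢y

  tidy-join : All (Tidy G) (B₁ ∷ B₂ ∷ rest) → All (Tidy G′) ((B₁ ++ B₂) ∷ rest)
  tidy-join (tidy₁ ∷ tidy₂ ∷ tidy-rest) =
    joined-tidy B₁ B₂ B₁#B₂ (leaf₁ tidy₁) (leaf₂ tidy₂) ∷ All.zipWith transport (tidy-rest , away)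
    where
    away : All (λ B → ∀ {v} → v ∈ₗ B → v ≢ x × v ≢ y) rest
    away = All.zipWith (λ (B₁#B , B₂#B) {v} v∈ → (λ { refl → B₁#B (x∈ , v∈) }) , (λ { refl → B₂#B (y∈ , v∈) }))
                       (All.tail (AllPairs.head (disjoint cs)) , AllPairs.head (AllPairs.tail (disjoint cs)))
    transport : ∀ {B} → Tidy G B × (∀ {v} → v ∈ₗ B → v ≢ x × v ≢ y) → Tidy G′ B
    transport {B} (tidy , apart) =
      TidyAs-transport (kind (length B)) (λ v∈ → Product.uncurry unchanged (apart v∈)) tidy

tidy-singletons : ∀ {n} → All (Tidy []) (singletons n)
tidy-singletons {n} = All.map⁺ (All.universal (λ v → deg-[] v ∷ []) (allFin n))

-- The upper bound: Mini keeps the excess small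

module ExcessControl (n m : ℕ) (3≤m : 3 ≤ m) where

  MaxToMove MiniToMove : Graph n → List (Block n) → Set
  MaxToMove  G bs = All (Tidy G) bs × 2 * excess G + load (census bs) + 1 ≤ n + bonus (census bs)
  MiniToMove G bs = All (Tidy G) bs × 2 * excess G + load (census bs) + debt (census bs) ≤ n

  Good : ℕ → Set
  Good s = s ≤ ⌈ n /2⌉ C m

  good-at-end : ∀ {G B} → Components G (B ∷ []) → 2 * excess G + load (census (B ∷ [])) ≤ n →
                Good (starScore (suc m) G)
  good-at-end {G} {B} cs small = begin
    starScore (suc m) G            ≡⟨ starScore≡∑deg (suc m) G (loopless cs) ⟩
    ∑ (λ v → deg G v C m)          ≤⟨ ∑-C≤ 3≤m (deg G) ⟩
    (2 + excess G) C m             ≤⟨ [2+X]Ck≤⌈n/2⌉Ck 3≤m (subst (λ s → 2 * excess G + weight (kind s) ≤ n) size-B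
                                      (subst (λ l → 2 * excess G + l ≤ n)
                                             (trans (load-⊕ _ (kind (length B))) (+-identityʳ _)) small)) ⟩
    ⌈ n /2⌉ C m                     ∎
    where
    open ≤-Reasoning
    size-B : length B ≡ n
    size-B = trans (sym (+-identityʳ (length B))) (size cs)

  mini-end : ∀ {G B} → Components G (B ∷ []) → MiniToMove G (B ∷ []) → Good (starScore (suc m) G)
  mini-end cs (_ , potential) = good-at-end cs (≤-trans (m≤m+n _ _) potential)

  max-end : ∀ {G B} → Components G (B ∷ []) → MaxToMove G (B ∷ []) → Good (starScore (suc m) G)
  max-end {B = B} cs (_ , potential) =
    good-at-end cs (+-cancelʳ-≤ 1 _ _ (≤-trans potential (+-monoʳ-≤ n (bonus≤1 (census (B ∷ []))))))

  max-move : ∀ {G B₁ B₂ rest x y} → Components G (B₁ ∷ B₂ ∷ rest) → x ∈ₗ B₁ → y ∈ₗ B₂ →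
             MaxToMove G (B₁ ∷ B₂ ∷ rest) → MiniToMove ((x , y) ∷ G) ((B₁ ++ B₂) ∷ rest)
  max-move {G} {B₁} {B₂} {rest} {x} {y} cs x∈ y∈ (tidy , before) = tidy-join cs x∈ y∈ tidy , after
    where
    κ₁ = kind (length B₁)
    κ₂ = kind (length B₂)
    c  = census rest
    move = join-move cs x∈ y∈
    grown : excess ((x , y) ∷ G) ≤ excess G + (isBig κ₁ + isBig κ₂)
    grown = excess-∷ (proj₁ move) (proj₁ (proj₂ move)) (isBig κ₁) (isBig κ₂)
              (excess-growth (All.head tidy) x∈) (excess-growth (All.head (All.tail tidy)) y∈)
    after : 2 * excess ((x , y) ∷ G) + load (census ((B₁ ++ B₂) ∷ rest)) + debt (census ((B₁ ++ B₂) ∷ rest))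
            ≤ n
    after rewrite census-join rest (All.head (nonempty cs)) (All.head (All.tail (nonempty cs)))
                | load-⊕ c (κ₁ ⋈ κ₂)
      = max-glue {X = excess G} {Δ = isBig κ₁ + isBig κ₂} {L = load c} {W₁ = weight κ₁} {W₂ = weight κ₂}
                 {w = weight (κ₁ ⋈ κ₂)} grown (max-gain c κ₁ κ₂)
                  (subst (λ l → 2 * excess G + l + 1 ≤ n + bonus (c ⊕ κ₂ ⊕ κ₁)) (load-⊕⊕ c κ₁ κ₂) before)

  join-at-leaves : ∀ {G bs B₁ B₂ rest} → bs ↭ B₁ ∷ B₂ ∷ rest →
                   Components G (B₁ ∷ B₂ ∷ rest) → All (Tidy G) (B₁ ∷ B₂ ∷ rest) →
                   let c = census rest; κ₁ = kind (length B₁); κ₂ = kind (length B₂) in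
                   MiniGain c κ₁ κ₂ → 2 * excess G + load (c ⊕ κ₂ ⊕ κ₁) + debt (c ⊕ κ₂ ⊕ κ₁) ≤ n →
                   Join MaxToMove G bs
  join-at-leaves {G} {bs} {B₁} {B₂} {rest} bs↭ cs tidy gain before
    with has-leaf (All.head tidy) (All.head (nonempty cs))
       | has-leaf (All.head (All.tail tidy)) (All.head (All.tail (nonempty cs)))
  ... | x , x∈ , leaf-x | y , y∈ , leaf-y = join-by B₁ B₂ rest bs↭ x∈ y∈ (tidy-join cs x∈ y∈ tidy , after)
    where
    κ₁ = kind (length B₁)
    κ₂ = kind (length B₂)
    c  = census rest
    move = join-move cs x∈ y∈
    kept : excess ((x , y) ∷ G) ≤ excess G
    kept = ≤-trans (excess-∷ (proj₁ move) (proj₁ (proj₂ move)) 0 0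
                              (d≤1⇒[1+d]∸2≤m leaf-x _) (d≤1⇒[1+d]∸2≤m leaf-y _))
                   (≤-reflexive (+-identityʳ _))
    after : 2 * excess ((x , y) ∷ G) + load (census ((B₁ ++ B₂) ∷ rest)) + 1
            ≤ n + bonus (census ((B₁ ++ B₂) ∷ rest))
    after rewrite census-join rest (All.head (nonempty cs)) (All.head (All.tail (nonempty cs)))
                | load-⊕ c (κ₁ ⋈ κ₂)
      = mini-glue {X = excess G} {L = load c} {W₁ = weight κ₁} {W₂ = weight κ₂} {w = weight (κ₁ ⋈ κ₂)}
                  kept gain (subst (λ l → 2 * excess G + l + debt (c ⊕ κ₂ ⊕ κ₁) ≤ n) (load-⊕⊕ c κ₁ κ₂) before)

  mini-move : ∀ {G B₁ B₂ rest} → Components G (B₁ ∷ B₂ ∷ rest) → MiniToMove G (B₁ ∷ B₂ ∷ rest) →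
              Join MaxToMove G (B₁ ∷ B₂ ∷ rest)
  mini-move {G} {B₁} {B₂} {rest} cs (tidy , before) with mini-choice (census (B₁ ∷ B₂ ∷ rest)) (2≤total B₁ B₂ rest)
  ... | c , κ₁ , κ₂ , census≡ , gain with find-kind (B₁ ∷ B₂ ∷ rest) κ₁ census≡
  ... | B₁′ , bs′ , bs↭₁ , refl , census′≡ with find-kind bs′ κ₂ census′≡
  ... | B₂′ , rest′ , bs′↭ , refl , refl =
    join-at-leaves bs↭ (Components-↭ bs↭ cs) (All-resp-↭ bs↭ tidy) gain
      (subst (λ c′ → 2 * excess G + load c′ + debt c′ ≤ n) census≡ before)
    where bs↭ = ↭.trans bs↭₁ (↭.prep B₁′ bs′↭)

  MaxToMove-↭ : ∀ {G bs bs′} → bs ↭ bs′ → MaxToMove G bs → MaxToMove G bs′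
  MaxToMove-↭ {G} bs↭ (tidy , potential) =
    All-resp-↭ bs↭ tidy , subst (λ c → 2 * excess G + load c + 1 ≤ n + bonus c) (census-↭ bs↭) potential

  open Strategy (starScore (suc m)) Mini Good MiniToMove MaxToMove
                mini-end max-end mini-move max-move MaxToMove-↭ public

opening-potential : ∀ n → 2 * excess {n} [] + load (census (singletons n)) ≡ n
opening-potential n = begin
  2 * excess {n} [] + load (census (singletons n))
    ≡⟨ cong₂ (λ X c → 2 * X + load c) (excess-[] {n}) (census-singletons n) ⟩
  n + 0 + 0
    ≡⟨ trans (+-identityʳ (n + 0)) (+-identityʳ n) ⟩
  n ∎
  where open ≡-Reasoning

opening-debt : ∀ n → debt (census (singletons n)) ≡ 0
opening-debt n = trans (cong debt (census-singletons n)) (go n)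
  where
  go : ∀ i → debt ⟨ i , 0 , 0 ⟩ ≡ 0
  go 0             = refl
  go 1             = refl
  go (suc (suc _)) = refl

upper-bound : ∀ n k → 3 < k → (first : Player) → UpperBound n k first (⌈ n /2⌉ C (k ∸ 1))
upper-bound zero    k       _         first = stop (λ { (() , _) }) z≤n
upper-bound (suc n) (suc m) (s≤s 3≤m) Mini  = forces-mine components-[] (tidy-singletons , opening)
  where
  open ExcessControl (suc n) m 3≤m
  opening : 2 * excess {suc n} [] + load (census (singletons (suc n))) + debt (census (singletons (suc n)))
            ≤ suc n
  opening = ≤-reflexive (trans (cong₂ _+_ (opening-potential (suc n)) (opening-debt (suc n))) (+-identityʳ _))
upper-bound (suc n) (suc m) (s≤s 3≤m) Max   = forces-theirs components-[] (tidy-singletons , opening)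
  where
  open ExcessControl (suc n) m 3≤m
  opening : 2 * excess {suc n} [] + load (census (singletons (suc n))) + 1
            ≤ suc n + bonus (census (singletons (suc n)))
  opening = ≤-reflexive (cong₂ _+_ (opening-potential (suc n)) (cong bonus (sym (census-singletons (suc n)))))

theorem1p5 : ∀ (k n : ℕ) → 4 < k → (first : Player) →
    LowerBound n k first ((n / 2) C (k ∸ 1))
      × UpperBound n k first (⌈ n /2⌉ C (k ∸ 1))
theorem1p5 k n 4<k first =
  lower-bound n k (≤-trans (s≤s (s≤s z≤n)) 4<k) first , upper-bound n k (≤-trans (n≤1+n 4) 4<k) first
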